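{- Let $p>3$ be a prime, let $R=1-p^{ -1}$ and let $W_p=\frac{(p-1)!+1}{p}$. If $p$ is a super-Wilson prime, i.e. $p^2\mid W_p$, then \[ 4\left(B_{p-1}-R\right)\equiv B_{2(p-1)}-R\pmod{p^2}. \]
   Context: $B_n$ denotes the $n$-th Bernoulli number, defined by $\frac{x}{e^x-1}=\sum_{n\ge0}B_n\frac{x^n}{n!}$. For rational numbers, $\alpha\equiv\beta\pmod{p^2}$ means $(\alpha-\beta)/p^2$ is $p$-integral. -}

module Defs where

open import Data.Nat as ℕ using (ℕ; zero; suc; _∸_)
open import Data.Nat.Combinatorics using (_C_)
open import Data.Nat.Divisibility using (_∣_)
open import Data.Nat.DivMod using () renaming (_/_ to _div_)
open import Data.Integer as ℤ using (ℤ; +_)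
open import Data.Rational as ℚ using (ℚ; ↥_; ↧ₙ_; 0ℚ; 1ℚ)
open import Data.Fin using (Fin; toℕ)
open import Data.Vec as Vec using (Vec; []; _∷_; _∷ʳ_; lookup; tabulate; foldr; last)
open import Data.Product using (_×_)
open import Relation.Nullary using (¬_)

-- Bernoulli numbers B_0, ..., B_n via the standard recurrence
--   B_0 = 1,  B_m = -(1/(m+1)) * Σ_{k=0}^{m-1} C(m+1,k) B_k   (m ≥ 1),
-- which is equivalent to x/(e^x-1) = Σ B_n x^n/n!  (so B_1 = -1/2).
private
  next : (n : ℕ) → Vec ℚ (suc n) → ℚ
  next n v =
    ℚ.- ((+ 1 ℚ./ suc (suc n)) ℚ.*
         foldr (λ _ → ℚ) ℚ._+_ 0ℚ
           (tabulate (λ (k : Fin (suc n)) →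
              (+ (suc (suc n) C toℕ k) ℚ./ 1) ℚ.* lookup v k)))

bernoulliVec : (n : ℕ) → Vec ℚ (suc n)
bernoulliVec zero = 1ℚ ∷ []
bernoulliVec (suc n) = bernoulliVec n ∷ʳ next n (bernoulliVec n)

B : ℕ → ℚ
B n = last (bernoulliVec n)

-- α ≡ β (mod m) for rationals: (α - β)/m is p-integral, i.e. with α - β = a/b
-- in lowest terms, m ∣ a and p ∤ b.  (Used with m = p², p prime.)
CongModPow : (p m : ℕ) → ℚ → ℚ → Set
CongModPow p m α β = (m ∣ ℤ.∣ ↥ (α ℚ.- β) ∣) × ¬ (p ∣ ↧ₙ (α ℚ.- β))

_≡_[modp²_] : ℚ → ℚ → ℕ → Set
α ≡ β [modp² p ] = CongModPow p (p ℕ.* p) α β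

W : (p : ℕ) → .{{_ : ℕ.NonZero p}} → ℕ
W p = (((p ∸ 1) ℕ.!) ℕ.+ 1) div p

R : (p : ℕ) → .{{_ : ℕ.NonZero p}} → ℚ
R p = 1ℚ ℚ.- (+ 1 ℚ./ p)

module Submission where

open import Level using (0ℓ)
open import Function using (_∘_; id)
open import Data.Empty using (⊥-elim)
open import Data.Product using (_×_; _,_; ∃-syntax)
open import Data.Sum using (_⊎_; inj₁; inj₂; [_,_]′)
open import Relation.Nullary using (¬_; yes; no)
open import Relation.Nullary.Decidable using (dec⇒maybe)
open import Relation.Binary.PropositionalEquality
open import Data.Nat as ℕ using (ℕ; zero; suc; _∸_; _≤_; _<_; z≤n; s≤s; _!)
import Data.Nat.Properties as ℕₚ
open import Data.Nat.Induction using (<-rec)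
open import Data.Nat.Combinatorics
  using (_C_; nCn≡1; nC1≡n; k>n⇒nCk≡0; nCk+nC[k+1]≡[n+1]C[k+1]; nCk≡n!/k![n-k]!; k![n∸k]!∣n!; nCk≡nC[n∸k])
open import Data.Nat.DivMod using (m/n*n≡m; m*[n/m]≡n)
open import Data.Nat.Divisibility
  using (_∣_; divides; ∣-refl; ∣-trans; ∣1⇒≡1; m∣m*n; ∣⇒≤; 1∣_; *-monoˡ-∣; *-cancelˡ-∣)
open import Data.Nat.Primality
  using (Prime; euclidsLemma; ¬prime[1]; prime⇒nonZero; prime⇒¬composite; composite-≢)
open import Data.Nat.Coprimality using (recompute)
import Data.Nat.Tactic.RingSolver as ℕ-Solver
open import Data.Integer as ℤ using (ℤ)
import Data.Integer.Properties as ℤₚ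
import Data.Integer.Tactic.RingSolver as ℤ-Solver
open import Data.Rational as ℚ using (ℚ; mkℚ; _+_; -_; _-_; _/_; 0ℚ; 1ℚ; ↥_; ↧ₙ_)
import Data.Rational.Properties as ℚₚ
open import Data.Rational.Literals using (fromℤ)
import Data.Rational.Unnormalised as ℚᵘ
import Data.Rational.Unnormalised.Properties as ℚᵘₚ
open import Data.Fin using (Fin; toℕ)
open import Data.Vec using (Vec; []; _∷_; _∷ʳ_; lookup; tabulate; foldr)
import Data.Vec.Properties as Vecₚ
open import Algebra.Bundles using (CommutativeRing)
open import Algebra.Properties.Group ℚₚ.+-0-group using (inverseʳ-unique)
open import Algebra.Properties.CommutativeSemiring.Exp
  (CommutativeRing.commutativeSemiring ℚₚ.+-*-commutativeRing) using (_^_; ^-homo-*; ^-distrib-*)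
open import Tactic.RingSolver using (solve-∀)
open import Tactic.RingSolver.Core.AlmostCommutativeRing using (AlmostCommutativeRing; fromCommutativeRing)
open import Defs

open ≡-Reasoning

-- Write Sₖ = ∑_{j<p} jᵏ. Faulhaber's formula at n = p gives (k+1)(p Bₖ − Sₖ) as a combination of the
-- terms C(k+1,i) Bᵢ p^(k+1−i), i < k. Using that Bᵢ is p-integral for i < p − 1, that p Bᵢ is p-integral
-- for i ≤ 2(p − 1), that odd Bᵢ vanish and that p ∣ C(p,i), all these terms are divisible by p⁴ when
-- k = p − 1 and by p³ when k = 2(p − 1); hence p Bₖ ≡ Sₖ (mod p³) for both k.
-- Next, write j^(p−1) = 1 + tⱼ with p ∣ tⱼ (Fermat). Then 4 S_{p−1} − S_{2p−2} − 3(p − 1) = ∑ (2tⱼ − tⱼ²),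
-- while ∏ (1 + tⱼ) = ((p−1)!)^(p−1) ≡ 1 (mod p³) for a super-Wilson prime. Expanding the product to
-- second order gives 2∑tⱼ + (∑tⱼ)² − ∑tⱼ² ≡ 0, which first forces p² ∣ ∑tⱼ and then p³ ∣ ∑(2tⱼ − tⱼ²).
-- Multiplying the claimed congruence by p turns it into the sum of these three congruences modulo p³.
-- Wilson's theorem, needed to read p² ∣ W_p as p³ ∣ (p−1)! + 1, comes from the finite-difference
-- identity ∑ₖ (−1)ᵏ C(n,k) kⁿ = (−1)ⁿ n! together with Fermat.

module Rationals where
  open import Data.Rational using (_*_)

  ℚ-ring : AlmostCommutativeRing 0ℓ 0ℓ
  ℚ-ring = fromCommutativeRing ℚₚ.+-*-commutativeRing (λ x → dec⇒maybe (0ℚ ℚₚ.≟ x))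

  fromℤ-homo-+ : ∀ a b → fromℤ (a ℤ.+ b) ≡ fromℤ a + fromℤ b
  fromℤ-homo-+ a b = ℚₚ.toℚᵘ-injective
    (ℚᵘₚ.≃-sym (ℚᵘₚ.≃-trans (ℚₚ.toℚᵘ-homo-+ (fromℤ a) (fromℤ b)) (ℚᵘ.*≡* (cross a b))))
    where
    cross : ∀ a b → (a ℤ.* ℤ.+ 1 ℤ.+ b ℤ.* ℤ.+ 1) ℤ.* ℤ.+ 1 ≡ (a ℤ.+ b) ℤ.* ℤ.+ 1
    cross = ℤ-Solver.solve-∀

  fromℤ-homo-* : ∀ a b → fromℤ (a ℤ.* b) ≡ fromℤ a * fromℤ b
  fromℤ-homo-* a b = ℚₚ.toℚᵘ-injective
    (ℚᵘₚ.≃-sym (ℚᵘₚ.≃-trans (ℚₚ.toℚᵘ-homo-* (fromℤ a) (fromℤ b)) (ℚᵘ.*≡* refl)))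

  fromℤ-homo‿- : ∀ a → fromℤ (ℤ.- a) ≡ - fromℤ a
  fromℤ-homo‿- a = ℚₚ.toℚᵘ-injective
    (ℚᵘₚ.≃-sym (ℚᵘₚ.≃-trans (ℚₚ.toℚᵘ-homo‿- (fromℤ a)) (ℚᵘ.*≡* refl)))

  fromℤ-injective : ∀ {a b} → fromℤ a ≡ fromℤ b → a ≡ b
  fromℤ-injective {a} {b} eq with ℚₚ.toℚᵘ-cong eq
  ... | ℚᵘ.*≡* a*1≡b*1 = trans (sym (ℤₚ.*-identityʳ a)) (trans a*1≡b*1 (ℤₚ.*-identityʳ b))

  fromℕ : ℕ → ℚ
  fromℕ n = fromℤ (ℤ.+ n)

  fromℕ-homo-+ : ∀ m n → fromℕ (m ℕ.+ n) ≡ fromℕ m + fromℕ n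
  fromℕ-homo-+ m n = fromℤ-homo-+ (ℤ.+ m) (ℤ.+ n)

  fromℕ-homo-* : ∀ m n → fromℕ (m ℕ.* n) ≡ fromℕ m * fromℕ n
  fromℕ-homo-* m n = trans (cong fromℤ (ℤₚ.pos-* m n)) (fromℤ-homo-* (ℤ.+ m) (ℤ.+ n))

  fromℕ-homo-^ : ∀ m k → fromℕ (m ℕ.^ k) ≡ fromℕ m ^ k
  fromℕ-homo-^ m zero    = refl
  fromℕ-homo-^ m (suc k) = trans (fromℕ-homo-* m (m ℕ.^ k)) (cong (fromℕ m *_) (fromℕ-homo-^ m k))

  fromℕ-suc : ∀ n → fromℕ (suc n) ≡ fromℕ n + 1ℚ
  fromℕ-suc n = trans (cong fromℕ (ℕₚ.+-comm 1 n)) (fromℕ-homo-+ n 1)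

  fromℕ-suc*1/suc : ∀ d → fromℕ (suc d) * (ℤ.+ 1 / suc d) ≡ 1ℚ
  fromℕ-suc*1/suc d = ℚₚ.toℚᵘ-injective
    (ℚᵘₚ.≃-trans (ℚₚ.toℚᵘ-homo-* (fromℕ (suc d)) (ℤ.+ 1 / suc d))
    (ℚᵘₚ.≃-trans (ℚᵘₚ.*-congˡ {ℚ.toℚᵘ (fromℕ (suc d))} (ℚₚ.toℚᵘ-fromℚᵘ (ℚᵘ.mkℚᵘ (ℤ.+ 1) d)))
    (ℚᵘ.*≡* (cong (λ e → ℤ.+ suc e) (denominators d)))))
    where
    denominators : ∀ d → d ℕ.* 1 ℕ.* 1 ≡ d ℕ.+ 0 ℕ.* suc d ℕ.+ 0 ℕ.* suc (d ℕ.+ 0 ℕ.* suc d)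
    denominators = ℕ-Solver.solve-∀

  fromℕ-suc-*-cancelˡ : ∀ d {x y} → fromℕ (suc d) * x ≡ fromℕ (suc d) * y → x ≡ y
  fromℕ-suc-*-cancelˡ d {x} {y} eq = begin
    x              ≡⟨ ℚₚ.*-identityˡ x ⟨
    1ℚ * x         ≡⟨ cong (_* x) (fromℕ-suc*1/suc d) ⟨
    (a * a⁻¹) * x  ≡⟨ rearrange a a⁻¹ x ⟩
    a⁻¹ * (a * x)  ≡⟨ cong (a⁻¹ *_) eq ⟩
    a⁻¹ * (a * y)  ≡⟨ rearrange a a⁻¹ y ⟨
    (a * a⁻¹) * y  ≡⟨ cong (_* y) (fromℕ-suc*1/suc d) ⟩
    1ℚ * y         ≡⟨ ℚₚ.*-identityˡ y ⟩
    y              ∎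
    where
    a   = fromℕ (suc d)
    a⁻¹ = ℤ.+ 1 / suc d
    rearrange : ∀ a b z → (a * b) * z ≡ b * (a * z)
    rearrange = solve-∀ ℚ-ring

  0ℚ^n≡0ℚ : ∀ n → .{{ℕ.NonZero n}} → 0ℚ ^ n ≡ 0ℚ
  0ℚ^n≡0ℚ (suc n) = ℚₚ.*-zeroˡ (0ℚ ^ n)

  1ℚ^n≡1ℚ : ∀ n → 1ℚ ^ n ≡ 1ℚ
  1ℚ^n≡1ℚ zero    = refl
  1ℚ^n≡1ℚ (suc n) = trans (ℚₚ.*-identityˡ (1ℚ ^ n)) (1ℚ^n≡1ℚ n)

  -1^n*-1^n≡1 : ∀ n → (- 1ℚ) ^ n * (- 1ℚ) ^ n ≡ 1ℚ
  -1^n*-1^n≡1 zero    = refl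
  -1^n*-1^n≡1 (suc n) = trans (square-neg ((- 1ℚ) ^ n)) (-1^n*-1^n≡1 n)
    where
    square-neg : ∀ x → (- 1ℚ * x) * (- 1ℚ * x) ≡ x * x
    square-neg = solve-∀ ℚ-ring

  -1^[n+n]≡1 : ∀ n → (- 1ℚ) ^ (n ℕ.+ n) ≡ 1ℚ
  -1^[n+n]≡1 n = trans (^-homo-* (- 1ℚ) n n) (-1^n*-1^n≡1 n)

  x≡-x⇒x≡0 : ∀ {x} → x ≡ - x → x ≡ 0ℚ
  x≡-x⇒x≡0 {x} x≡-x = fromℕ-suc-*-cancelˡ 1 (begin
    fromℕ 2 * x   ≡⟨ double x ⟩
    x + x         ≡⟨ cong (x +_) x≡-x ⟩
    x + - x       ≡⟨ ℚₚ.+-inverseʳ x ⟩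
    0ℚ            ≡⟨ ℚₚ.*-zeroʳ (fromℕ 2) ⟨
    fromℕ 2 * 0ℚ  ∎)
    where
    double : ∀ x → fromℕ 2 * x ≡ x + x
    double = solve-∀ ℚ-ring

module Sums where
  open import Data.Rational using (_*_)
  open Rationals

  ∑ : ℕ → (ℕ → ℚ) → ℚ
  ∑ zero    f = 0ℚ
  ∑ (suc n) f = ∑ n f + f n

  syntax ∑ n (λ i → e) = ∑[ i < n ] e

  ∑-cong : ∀ {f g} n → (∀ i → i < n → f i ≡ g i) → ∑ n f ≡ ∑ n g
  ∑-cong zero    f≡g = refl
  ∑-cong (suc n) f≡g = cong₂ _+_ (∑-cong n (λ i i<n → f≡g i (ℕₚ.m<n⇒m<1+n i<n))) (f≡g n (ℕₚ.n<1+n n))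

  ∑-zero : ∀ n {f} → (∀ i → i < n → f i ≡ 0ℚ) → ∑ n f ≡ 0ℚ
  ∑-zero zero    f≡0 = refl
  ∑-zero (suc n) f≡0 = cong₂ _+_ (∑-zero n (λ i i<n → f≡0 i (ℕₚ.m<n⇒m<1+n i<n))) (f≡0 n (ℕₚ.n<1+n n))

  ∑-distrib-+ : ∀ n f g → ∑[ i < n ] (f i + g i) ≡ ∑ n f + ∑ n g
  ∑-distrib-+ zero    f g = refl
  ∑-distrib-+ (suc n) f g = trans (cong (_+ (f n + g n)) (∑-distrib-+ n f g)) (interchange (∑ n f) (∑ n g) (f n) (g n))
    where
    interchange : ∀ a b c d → a + b + (c + d) ≡ a + c + (b + d)
    interchange = solve-∀ ℚ-ring

  ∑-neg : ∀ n f → ∑[ i < n ] (- f i) ≡ - ∑ n f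
  ∑-neg zero    f = refl
  ∑-neg (suc n) f = trans (cong (_+ - f n) (∑-neg n f)) (sym (ℚₚ.neg-distrib-+ (∑ n f) (f n)))

  ∑-distrib-- : ∀ n f g → ∑[ i < n ] (f i - g i) ≡ ∑ n f - ∑ n g
  ∑-distrib-- n f g = trans (∑-distrib-+ n f (λ i → - g i)) (cong (∑ n f +_) (∑-neg n g))

  *-distribˡ-∑ : ∀ c n f → c * ∑ n f ≡ ∑[ i < n ] (c * f i)
  *-distribˡ-∑ c zero    f = ℚₚ.*-zeroʳ c
  *-distribˡ-∑ c (suc n) f = trans (ℚₚ.*-distribˡ-+ c (∑ n f) (f n)) (cong (_+ c * f n) (*-distribˡ-∑ c n f))

  ∑-const : ∀ n c → ∑[ _ < n ] c ≡ fromℕ n * c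
  ∑-const zero    c = sym (ℚₚ.*-zeroˡ c)
  ∑-const (suc n) c = begin
    ∑[ _ < n ] c + c      ≡⟨ cong (_+ c) (∑-const n c) ⟩
    fromℕ n * c + c       ≡⟨ distrib (fromℕ n) c ⟩
    (fromℕ n + 1ℚ) * c    ≡⟨ cong (_* c) (fromℕ-suc n) ⟨
    fromℕ (suc n) * c     ∎
    where
    distrib : ∀ m c → m * c + c ≡ (m + 1ℚ) * c
    distrib = solve-∀ ℚ-ring

  ∑-unfoldˡ : ∀ n f → ∑ (suc n) f ≡ f 0 + ∑[ i < n ] f (suc i)
  ∑-unfoldˡ zero    f = ℚₚ.+-comm 0ℚ (f 0)
  ∑-unfoldˡ (suc n) f = trans (cong (_+ f (suc n)) (∑-unfoldˡ n f)) (ℚₚ.+-assoc (f 0) _ _)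

  ∑-reverse : ∀ n f → ∑ n f ≡ ∑[ i < n ] f (n ∸ suc i)
  ∑-reverse zero    f = refl
  ∑-reverse (suc n) f = begin
    ∑ n f + f n                                  ≡⟨ cong (_+ f n) (∑-reverse n f) ⟩
    ∑[ i < n ] f (n ∸ suc i) + f n               ≡⟨ ℚₚ.+-comm _ (f n) ⟩
    f n + ∑[ i < n ] f (suc n ∸ suc (suc i))     ≡⟨ ∑-unfoldˡ n (λ i → f (suc n ∸ suc i)) ⟨
    ∑[ i < suc n ] f (suc n ∸ suc i)             ∎

  ∑-swap : ∀ m n (g : ℕ → ℕ → ℚ) → ∑[ i < n ] ∑ m (g i) ≡ ∑[ j < m ] ∑[ i < n ] g i j
  ∑-swap m zero    g = sym (∑-zero m (λ _ _ → refl))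
  ∑-swap m (suc n) g = trans (cong (_+ ∑ m (g n)) (∑-swap m n g)) (sym (∑-distrib-+ m (λ j → ∑[ i < n ] g i j) (g n)))

  ∑-triangle : ∀ n (h : ℕ → ℕ → ℚ) →
    ∑[ k < n ] ∑[ j < suc k ] h k j ≡ ∑[ j < n ] ∑[ l < n ∸ j ] h (j ℕ.+ l) j
  ∑-triangle zero    h = refl
  ∑-triangle (suc n) h = begin
    ∑[ k < n ] ∑ (suc k) (h k) + (∑ n (h n) + h n n)
      ≡⟨ cong (_+ (∑ n (h n) + h n n)) (∑-triangle n h) ⟩
    columns n + (∑ n (h n) + h n n)
      ≡⟨ ℚₚ.+-assoc (columns n) (∑ n (h n)) (h n n) ⟨
    (columns n + ∑ n (h n)) + h n n
      ≡⟨ cong₂ _+_ (∑-distrib-+ n (λ j → ∑[ l < n ∸ j ] h (j ℕ.+ l) j) (h n)) (sym last-column) ⟨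
    ∑[ j < n ] (∑[ l < n ∸ j ] h (j ℕ.+ l) j + h n j) + ∑[ l < suc n ∸ n ] h (n ℕ.+ l) n
      ≡⟨ cong (_+ ∑[ l < suc n ∸ n ] h (n ℕ.+ l) n) (∑-cong n extend) ⟩
    ∑[ j < n ] ∑[ l < suc n ∸ j ] h (j ℕ.+ l) j + ∑[ l < suc n ∸ n ] h (n ℕ.+ l) n
      ∎
    where
    columns : ℕ → ℚ
    columns m = ∑[ j < m ] ∑[ l < m ∸ j ] h (j ℕ.+ l) j
    extend : ∀ j → j < n → ∑[ l < n ∸ j ] h (j ℕ.+ l) j + h n j ≡ ∑[ l < suc n ∸ j ] h (j ℕ.+ l) j
    extend j j<n = begin
      ∑[ l < n ∸ j ] h (j ℕ.+ l) j + h n j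
        ≡⟨ cong (λ m → ∑[ l < n ∸ j ] h (j ℕ.+ l) j + h m j) (ℕₚ.m+[n∸m]≡n (ℕₚ.<⇒≤ j<n)) ⟨
      ∑[ l < suc (n ∸ j) ] h (j ℕ.+ l) j
        ≡⟨ cong (λ m → ∑[ l < m ] h (j ℕ.+ l) j) (ℕₚ.+-∸-assoc 1 (ℕₚ.<⇒≤ j<n)) ⟨
      ∑[ l < suc n ∸ j ] h (j ℕ.+ l) j
        ∎
    last-column : h n n ≡ ∑[ l < suc n ∸ n ] h (n ℕ.+ l) n
    last-column = begin
      h n n                              ≡⟨ cong (λ m → h m n) (ℕₚ.+-identityʳ n) ⟨
      h (n ℕ.+ 0) n                      ≡⟨ ℚₚ.+-identityˡ _ ⟨
      ∑[ l < 1 ] h (n ℕ.+ l) n           ≡⟨ cong (λ m → ∑[ l < m ] h (n ℕ.+ l) n) (ℕₚ.m+n∸n≡m 1 n) ⟨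
      ∑[ l < suc n ∸ n ] h (n ℕ.+ l) n   ∎

  ∑-swap-triangle : ∀ K (g : ℕ → ℕ → ℚ) →
    ∑[ i < K ] ∑[ j < K ∸ i ] g i j ≡ ∑[ j < K ] ∑[ i < K ∸ j ] g i j
  ∑-swap-triangle K g = begin
    ∑[ i < K ] ∑[ j < K ∸ i ] g i j
      ≡⟨ ∑-cong K (λ i _ → ∑-cong (K ∸ i) (λ l _ → cong (g i) (ℕₚ.m+n∸m≡n i l))) ⟨
    ∑[ i < K ] ∑[ l < K ∸ i ] g i ((i ℕ.+ l) ∸ i)
      ≡⟨ ∑-triangle K (λ k i → g i (k ∸ i)) ⟨
    ∑[ k < K ] ∑[ i < suc k ] g i (k ∸ i)
      ≡⟨ ∑-cong K (λ k _ → trans (∑-reverse (suc k) (λ i → g i (k ∸ i)))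
           (∑-cong (suc k) (λ i i≤k → cong (g (k ∸ i)) (ℕₚ.m∸[m∸n]≡n (ℕₚ.≤-pred i≤k))))) ⟩
    ∑[ k < K ] ∑[ j < suc k ] g (k ∸ j) j
      ≡⟨ ∑-triangle K (λ k j → g (k ∸ j) j) ⟩
    ∑[ j < K ] ∑[ l < K ∸ j ] g ((j ℕ.+ l) ∸ j) j
      ≡⟨ ∑-cong K (λ j _ → ∑-cong (K ∸ j) (λ l _ → cong (λ i → g i j) (ℕₚ.m+n∸m≡n j l))) ⟩
    ∑[ j < K ] ∑[ i < K ∸ j ] g i j
      ∎

  ∏ : ℕ → (ℕ → ℚ) → ℚ
  ∏ zero    f = 1ℚ
  ∏ (suc n) f = ∏ n f * f n

  syntax ∏ n (λ i → e) = ∏[ i < n ] e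

  ∏-cong : ∀ {f g} n → (∀ i → i < n → f i ≡ g i) → ∏ n f ≡ ∏ n g
  ∏-cong zero    f≡g = refl
  ∏-cong (suc n) f≡g = cong₂ _*_ (∏-cong n (λ i i<n → f≡g i (ℕₚ.m<n⇒m<1+n i<n))) (f≡g n (ℕₚ.n<1+n n))

  ∏-powers-factorial : ∀ n m → ∏[ j < n ] (fromℕ (suc j) ^ m) ≡ fromℕ (n !) ^ m
  ∏-powers-factorial zero    m = sym (1ℚ^n≡1ℚ m)
  ∏-powers-factorial (suc n) m = begin
    ∏[ j < n ] (fromℕ (suc j) ^ m) * fromℕ (suc n) ^ m  ≡⟨ cong (_* fromℕ (suc n) ^ m) (∏-powers-factorial n m) ⟩
    fromℕ (n !) ^ m * fromℕ (suc n) ^ m                 ≡⟨ ^-distrib-* (fromℕ (n !)) (fromℕ (suc n)) m ⟨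
    (fromℕ (n !) * fromℕ (suc n)) ^ m                   ≡⟨ cong (_^ m) (fromℕ-homo-* (n !) (suc n)) ⟨
    fromℕ (n ! ℕ.* suc n) ^ m                           ≡⟨ cong (λ k → fromℕ k ^ m) (ℕₚ.*-comm (n !) (suc n)) ⟩
    fromℕ (suc n !) ^ m                                 ∎

module Binomials where
  open import Data.Rational using (_*_)
  open Rationals
  open Sums

  nCk*[k!*[n∸k]!]≡n! : ∀ {n k} → k ≤ n → (n C k) ℕ.* (k ! ℕ.* (n ∸ k) !) ≡ n !
  nCk*[k!*[n∸k]!]≡n! {n} {k} k≤n = trans (cong (ℕ._* (k ! ℕ.* (n ∸ k) !)) (nCk≡n!/k![n-k]! k≤n)) (m/n*n≡m (k![n∸k]!∣n! k≤n))
    where instance _ = ℕₚ.m*n≢0 (k !) ((n ∸ k) !) {{k ℕₚ.!≢0}} {{(n ∸ k) ℕₚ.!≢0}}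

  [m+n]Cm*[m!*n!]≡[m+n]! : ∀ m n → ((m ℕ.+ n) C m) ℕ.* (m ! ℕ.* n !) ≡ (m ℕ.+ n) !
  [m+n]Cm*[m!*n!]≡[m+n]! m n =
    subst (λ k → ((m ℕ.+ n) C m) ℕ.* (m ! ℕ.* k !) ≡ (m ℕ.+ n) !) (ℕₚ.m+n∸m≡n m n) (nCk*[k!*[n∸k]!]≡n! (ℕₚ.m≤m+n m n))

  [n+1]Cn≡n+1 : ∀ n → suc n C n ≡ suc n
  [n+1]Cn≡n+1 n = begin
    suc n C n             ≡⟨ nCk≡nC[n∸k] (ℕₚ.n≤1+n n) ⟩
    suc n C (suc n ∸ n)   ≡⟨ cong (suc n C_) (ℕₚ.m+n∸n≡m 1 n) ⟩
    suc n C 1             ≡⟨ nC1≡n (suc n) ⟩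
    suc n                 ∎

  C-trinomial : ∀ n j l → j ℕ.+ l ≤ n → (n C (j ℕ.+ l)) ℕ.* ((j ℕ.+ l) C j) ≡ (n C j) ℕ.* ((n ∸ j) C l)
  C-trinomial n j l j+l≤n =
    subst (λ m → (m C (j ℕ.+ l)) ℕ.* ((j ℕ.+ l) C j) ≡ (m C j) ℕ.* ((m ∸ j) C l)) (ℕₚ.m+[n∸m]≡n j+l≤n)
      (ℕₚ.*-cancelʳ-≡ _ _ (j ! ℕ.* (l ! ℕ.* r !)) {{factorials≢0}} (trans split-j+l (sym split-j)))
    where
    r = n ∸ (j ℕ.+ l)
    factorials≢0 : ℕ.NonZero (j ! ℕ.* (l ! ℕ.* r !))
    factorials≢0 = ℕₚ.m*n≢0 (j !) (l ! ℕ.* r !) {{j ℕₚ.!≢0}} {{ℕₚ.m*n≢0 (l !) (r !) {{l ℕₚ.!≢0}} {{r ℕₚ.!≢0}}}}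
    split-j+l : ((j ℕ.+ l ℕ.+ r) C (j ℕ.+ l)) ℕ.* ((j ℕ.+ l) C j) ℕ.* (j ! ℕ.* (l ! ℕ.* r !)) ≡ (j ℕ.+ l ℕ.+ r) !
    split-j+l = begin
      ((j ℕ.+ l ℕ.+ r) C (j ℕ.+ l)) ℕ.* ((j ℕ.+ l) C j) ℕ.* (j ! ℕ.* (l ! ℕ.* r !))
        ≡⟨ regroup ((j ℕ.+ l ℕ.+ r) C (j ℕ.+ l)) ((j ℕ.+ l) C j) (j !) (l !) (r !) ⟩
      ((j ℕ.+ l ℕ.+ r) C (j ℕ.+ l)) ℕ.* ((((j ℕ.+ l) C j) ℕ.* (j ! ℕ.* l !)) ℕ.* r !)
        ≡⟨ cong (λ z → ((j ℕ.+ l ℕ.+ r) C (j ℕ.+ l)) ℕ.* (z ℕ.* r !)) ([m+n]Cm*[m!*n!]≡[m+n]! j l) ⟩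
      ((j ℕ.+ l ℕ.+ r) C (j ℕ.+ l)) ℕ.* ((j ℕ.+ l) ! ℕ.* r !)
        ≡⟨ [m+n]Cm*[m!*n!]≡[m+n]! (j ℕ.+ l) r ⟩
      (j ℕ.+ l ℕ.+ r) !
        ∎
      where
      regroup : ∀ a b x y z → a ℕ.* b ℕ.* (x ℕ.* (y ℕ.* z)) ≡ a ℕ.* ((b ℕ.* (x ℕ.* y)) ℕ.* z)
      regroup = ℕ-Solver.solve-∀
    split-j : ((j ℕ.+ l ℕ.+ r) C j) ℕ.* ((j ℕ.+ l ℕ.+ r ∸ j) C l) ℕ.* (j ! ℕ.* (l ! ℕ.* r !)) ≡ (j ℕ.+ l ℕ.+ r) !
    split-j = begin
      ((j ℕ.+ l ℕ.+ r) C j) ℕ.* ((j ℕ.+ l ℕ.+ r ∸ j) C l) ℕ.* (j ! ℕ.* (l ! ℕ.* r !))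
        ≡⟨ cong₂ (λ m m′ → (m C j) ℕ.* (m′ C l) ℕ.* (j ! ℕ.* (l ! ℕ.* r !))) (ℕₚ.+-assoc j l r) l+r≡ ⟩
      (((j ℕ.+ (l ℕ.+ r)) C j) ℕ.* ((l ℕ.+ r) C l)) ℕ.* (j ! ℕ.* (l ! ℕ.* r !))
        ≡⟨ regroup ((j ℕ.+ (l ℕ.+ r)) C j) ((l ℕ.+ r) C l) (j !) (l !) (r !) ⟩
      ((j ℕ.+ (l ℕ.+ r)) C j) ℕ.* (j ! ℕ.* (((l ℕ.+ r) C l) ℕ.* (l ! ℕ.* r !)))
        ≡⟨ cong (λ z → ((j ℕ.+ (l ℕ.+ r)) C j) ℕ.* (j ! ℕ.* z)) ([m+n]Cm*[m!*n!]≡[m+n]! l r) ⟩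
      ((j ℕ.+ (l ℕ.+ r)) C j) ℕ.* (j ! ℕ.* (l ℕ.+ r) !)
        ≡⟨ [m+n]Cm*[m!*n!]≡[m+n]! j (l ℕ.+ r) ⟩
      (j ℕ.+ (l ℕ.+ r)) !
        ≡⟨ cong _! (ℕₚ.+-assoc j l r) ⟨
      (j ℕ.+ l ℕ.+ r) !
        ∎
      where
      l+r≡ : j ℕ.+ l ℕ.+ r ∸ j ≡ l ℕ.+ r
      l+r≡ = trans (cong (_∸ j) (ℕₚ.+-assoc j l r)) (ℕₚ.m+n∸m≡n j (l ℕ.+ r))
      regroup : ∀ a b x y z → a ℕ.* b ℕ.* (x ℕ.* (y ℕ.* z)) ≡ a ℕ.* (x ℕ.* (b ℕ.* (y ℕ.* z)))
      regroup = ℕ-Solver.solve-∀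

  C-swap : ∀ K i j → i ℕ.+ j ≤ K → (K C i) ℕ.* ((K ∸ i) C j) ≡ (K C j) ℕ.* ((K ∸ j) C i)
  C-swap K i j i+j≤K = begin
    (K C i) ℕ.* ((K ∸ i) C j)            ≡⟨ C-trinomial K i j i+j≤K ⟨
    (K C (i ℕ.+ j)) ℕ.* ((i ℕ.+ j) C i)  ≡⟨ cong₂ (λ u v → (K C u) ℕ.* v) (ℕₚ.+-comm i j) (C-complement i j) ⟩
    (K C (j ℕ.+ i)) ℕ.* ((j ℕ.+ i) C j)  ≡⟨ C-trinomial K j i (subst (_≤ K) (ℕₚ.+-comm i j) i+j≤K) ⟩
    (K C j) ℕ.* ((K ∸ j) C i)            ∎
    where
    C-complement : ∀ i j → (i ℕ.+ j) C i ≡ (j ℕ.+ i) C j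
    C-complement i j = begin
      (i ℕ.+ j) C i              ≡⟨ nCk≡nC[n∸k] (ℕₚ.m≤m+n i j) ⟩
      (i ℕ.+ j) C (i ℕ.+ j ∸ i)  ≡⟨ cong₂ _C_ (ℕₚ.+-comm i j) (ℕₚ.m+n∸m≡n i j) ⟩
      (j ℕ.+ i) C j              ∎

  _Cℚ_ : ℕ → ℕ → ℚ
  n Cℚ k = fromℕ (n C k)

  Cℚ-pascal : ∀ n k → suc n Cℚ suc k ≡ n Cℚ k + n Cℚ suc k
  Cℚ-pascal n k = trans (cong fromℕ (sym (nCk+nC[k+1]≡[n+1]C[k+1] n k))) (fromℕ-homo-+ (n C k) (n C suc k))

  nCℚn≡1 : ∀ n → n Cℚ n ≡ 1ℚ
  nCℚn≡1 n = cong fromℕ (nCn≡1 n)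

  binomial : ∀ x m → (x + 1ℚ) ^ m ≡ ∑[ j < suc m ] (m Cℚ j * x ^ j)
  binomial x zero    = refl
  binomial x (suc m) = begin
    (x + 1ℚ) * (x + 1ℚ) ^ m
      ≡⟨ cong ((x + 1ℚ) *_) (binomial x m) ⟩
    (x + 1ℚ) * T
      ≡⟨ expand x T ⟩
    x * T + T
      ≡⟨ cong₂ _+_ (*-distribˡ-∑ x (suc m) (λ j → m Cℚ j * x ^ j)) (∑-unfoldˡ m (λ j → m Cℚ j * x ^ j)) ⟩
    ∑[ j < suc m ] (x * (m Cℚ j * x ^ j)) + (1ℚ + ∑[ j < m ] (m Cℚ suc j * x ^ suc j))
      ≡⟨ cong (λ z → ∑[ j < suc m ] (x * (m Cℚ j * x ^ j)) + (1ℚ + z)) top-vanishes ⟩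
    ∑[ j < suc m ] (x * (m Cℚ j * x ^ j)) + (1ℚ + ∑[ j < suc m ] (m Cℚ suc j * x ^ suc j))
      ≡⟨ shuffle (∑[ j < suc m ] (x * (m Cℚ j * x ^ j))) (∑[ j < suc m ] (m Cℚ suc j * x ^ suc j)) 1ℚ ⟩
    1ℚ + (∑[ j < suc m ] (x * (m Cℚ j * x ^ j)) + ∑[ j < suc m ] (m Cℚ suc j * x ^ suc j))
      ≡⟨ cong (1ℚ +_) (∑-distrib-+ (suc m) (λ j → x * (m Cℚ j * x ^ j)) (λ j → m Cℚ suc j * x ^ suc j)) ⟨
    1ℚ + ∑[ j < suc m ] (x * (m Cℚ j * x ^ j) + m Cℚ suc j * x ^ suc j)
      ≡⟨ cong (1ℚ +_) (∑-cong (suc m) (λ j _ → pascal-term j)) ⟩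
    1ℚ + ∑[ j < suc m ] (suc m Cℚ suc j * x ^ suc j)
      ≡⟨ ∑-unfoldˡ (suc m) (λ j → suc m Cℚ j * x ^ j) ⟨
    ∑[ j < suc (suc m) ] (suc m Cℚ j * x ^ j)
      ∎
    where
    T = ∑[ j < suc m ] (m Cℚ j * x ^ j)
    expand : ∀ x T → (x + 1ℚ) * T ≡ x * T + T
    expand = solve-∀ ℚ-ring
    shuffle : ∀ a b c → a + (c + b) ≡ c + (a + b)
    shuffle = solve-∀ ℚ-ring
    top-vanishes : ∑[ j < m ] (m Cℚ suc j * x ^ suc j) ≡ ∑[ j < suc m ] (m Cℚ suc j * x ^ suc j)
    top-vanishes = begin
      ∑[ j < m ] (m Cℚ suc j * x ^ suc j)                        ≡⟨ ℚₚ.+-identityʳ _ ⟨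
      ∑[ j < m ] (m Cℚ suc j * x ^ suc j) + 0ℚ                   ≡⟨ cong (∑[ j < m ] (m Cℚ suc j * x ^ suc j) +_) (ℚₚ.*-zeroˡ (x ^ suc m)) ⟨
      ∑[ j < m ] (m Cℚ suc j * x ^ suc j) + 0ℚ * x ^ suc m        ≡⟨ cong (λ c → ∑[ j < m ] (m Cℚ suc j * x ^ suc j) + fromℕ c * x ^ suc m) (k>n⇒nCk≡0 (ℕₚ.n<1+n m)) ⟨
      ∑[ j < suc m ] (m Cℚ suc j * x ^ suc j)                    ∎
    pascal-term : ∀ j → x * (m Cℚ j * x ^ j) + m Cℚ suc j * x ^ suc j ≡ suc m Cℚ suc j * x ^ suc j
    pascal-term j = trans (collect x (m Cℚ j) (m Cℚ suc j) (x ^ j)) (cong (_* x ^ suc j) (sym (Cℚ-pascal m j)))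
      where
      collect : ∀ x a b y → x * (a * y) + b * (x * y) ≡ (a + b) * (x * y)
      collect = solve-∀ ℚ-ring

  ∑-alternating-binomial : ∀ M → ∑[ l < suc M ] ((- 1ℚ) ^ l * suc M Cℚ l) ≡ - (- 1ℚ) ^ suc M
  ∑-alternating-binomial M = begin
    ∑[ l < suc M ] ((- 1ℚ) ^ l * suc M Cℚ l)
      ≡⟨ cancel-top (∑[ l < suc M ] ((- 1ℚ) ^ l * suc M Cℚ l)) ((- 1ℚ) ^ suc M) ⟩
    (∑[ l < suc M ] ((- 1ℚ) ^ l * suc M Cℚ l) + (- 1ℚ) ^ suc M * 1ℚ) - (- 1ℚ) ^ suc M
      ≡⟨ cong (λ c → (∑[ l < suc M ] ((- 1ℚ) ^ l * suc M Cℚ l) + (- 1ℚ) ^ suc M * c) - (- 1ℚ) ^ suc M) (nCℚn≡1 (suc M)) ⟨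
    ∑[ l < suc (suc M) ] ((- 1ℚ) ^ l * suc M Cℚ l) - (- 1ℚ) ^ suc M
      ≡⟨ cong (_- (- 1ℚ) ^ suc M) (∑-cong (suc (suc M)) (λ l _ → ℚₚ.*-comm ((- 1ℚ) ^ l) (suc M Cℚ l))) ⟩
    ∑[ l < suc (suc M) ] (suc M Cℚ l * (- 1ℚ) ^ l) - (- 1ℚ) ^ suc M
      ≡⟨ cong (_- (- 1ℚ) ^ suc M) (binomial (- 1ℚ) (suc M)) ⟨
    (- 1ℚ + 1ℚ) ^ suc M - (- 1ℚ) ^ suc M
      ≡⟨ cong (_- (- 1ℚ) ^ suc M) (ℚₚ.*-zeroˡ (0ℚ ^ M)) ⟩
    0ℚ - (- 1ℚ) ^ suc M
      ≡⟨ ℚₚ.+-identityˡ _ ⟩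
    - (- 1ℚ) ^ suc M
      ∎
    where
    cancel-top : ∀ s t → s ≡ (s + t * 1ℚ) - t
    cancel-top = solve-∀ ℚ-ring

  binomial-split-last : ∀ x M → (x + 1ℚ) ^ M ≡ ∑[ j < M ] (M Cℚ j * x ^ j) + x ^ M
  binomial-split-last x M = trans (binomial x M)
    (cong (∑[ j < M ] (M Cℚ j * x ^ j) +_) (trans (cong (_* x ^ M) (nCℚn≡1 M)) (ℚₚ.*-identityˡ (x ^ M))))

module Bernoulli where
  open import Data.Rational using (_*_)
  open Rationals
  open Sums
  open Binomials

  /1≡fromℤ : ∀ a → a / 1 ≡ fromℤ a
  /1≡fromℤ a = ℚₚ.toℚᵘ-injective (ℚₚ.toℚᵘ-fromℚᵘ (ℚᵘ.mkℚᵘ a 0))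

  lookup-∷ʳ : ∀ {n} (xs : Vec ℚ n) x (f : ℕ → ℚ) → (∀ k → lookup xs k ≡ f (toℕ k)) → x ≡ f n →
              ∀ k → lookup (xs ∷ʳ x) k ≡ f (toℕ k)
  lookup-∷ʳ []       x f xs≡f x≡f Fin.zero    = x≡f
  lookup-∷ʳ (y ∷ ys) x f xs≡f x≡f Fin.zero    = xs≡f Fin.zero
  lookup-∷ʳ (y ∷ ys) x f xs≡f x≡f (Fin.suc k) = lookup-∷ʳ ys x (f ∘ suc) (xs≡f ∘ Fin.suc) x≡f k

  bernoulliVec-∷ʳ : ∀ n → bernoulliVec (suc n) ≡ bernoulliVec n ∷ʳ B (suc n)
  bernoulliVec-∷ʳ n = cong (bernoulliVec n ∷ʳ_) (sym (Vecₚ.last-∷ʳ _ (bernoulliVec n)))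

  lookup-bernoulliVec : ∀ n k → lookup (bernoulliVec n) k ≡ B (toℕ k)
  lookup-bernoulliVec zero    Fin.zero = refl
  lookup-bernoulliVec (suc n) k = trans (cong (λ v → lookup v k) (bernoulliVec-∷ʳ n))
    (lookup-∷ʳ (bernoulliVec n) (B (suc n)) B (lookup-bernoulliVec n) refl k)

  foldr-+-tabulate : ∀ n (f : ℕ → ℚ) → foldr (λ _ → ℚ) _+_ 0ℚ (tabulate {n = n} (f ∘ toℕ)) ≡ ∑ n f
  foldr-+-tabulate zero    f = refl
  foldr-+-tabulate (suc n) f = trans (cong (f 0 +_) (foldr-+-tabulate n (f ∘ suc))) (sym (∑-unfoldˡ n f))

  B-suc : ∀ n → B (suc n) ≡ - ((ℤ.+ 1 / suc (suc n)) * ∑[ i < suc n ] (suc (suc n) Cℚ i * B i))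
  B-suc n = trans (Vecₚ.last-∷ʳ _ (bernoulliVec n))
    (cong (λ s → - ((ℤ.+ 1 / suc (suc n)) * s))
      (trans (cong (foldr (λ _ → ℚ) _+_ 0ℚ) (Vecₚ.tabulate-cong term))
             (foldr-+-tabulate (suc n) (λ i → suc (suc n) Cℚ i * B i))))
    where
    term : ∀ k → (ℤ.+ (suc (suc n) C toℕ k) / 1) * lookup (bernoulliVec n) k ≡ suc (suc n) Cℚ toℕ k * B (toℕ k)
    term k = cong₂ _*_ (/1≡fromℤ _) (lookup-bernoulliVec n k)

  B-recurrence : ∀ m → ∑[ k < suc (suc m) ] (suc (suc m) Cℚ k * B k) ≡ 0ℚ
  B-recurrence m = begin
    S + suc (suc m) Cℚ suc m * B (suc m)
      ≡⟨ cong₂ (λ c b → S + fromℕ c * b) ([n+1]Cn≡n+1 (suc m)) (B-suc m) ⟩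
    S + fromℕ (suc (suc m)) * (- ((ℤ.+ 1 / suc (suc m)) * S))
      ≡⟨ regroup S (fromℕ (suc (suc m))) (ℤ.+ 1 / suc (suc m)) ⟩
    S - (fromℕ (suc (suc m)) * (ℤ.+ 1 / suc (suc m))) * S
      ≡⟨ cong (λ z → S - z * S) (fromℕ-suc*1/suc (suc m)) ⟩
    S - 1ℚ * S
      ≡⟨ cancel S ⟩
    0ℚ ∎
    where
    S = ∑[ i < suc m ] (suc (suc m) Cℚ i * B i)
    regroup : ∀ S a i → S + a * (- (i * S)) ≡ S - (a * i) * S
    regroup = solve-∀ ℚ-ring
    cancel : ∀ S → S - 1ℚ * S ≡ 0ℚ
    cancel = solve-∀ ℚ-ring

  BernoulliRecurrence : (ℕ → ℚ) → Set
  BernoulliRecurrence b = b 0 ≡ 1ℚ × (∀ m → ∑[ k < suc (suc m) ] (suc (suc m) Cℚ k * b k) ≡ 0ℚ)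

  recurrence-last-term : ∀ m (b : ℕ → ℚ) → ∑[ k < suc (suc m) ] (suc (suc m) Cℚ k * b k) ≡ 0ℚ →
             fromℕ (suc (suc m)) * b (suc m) ≡ - ∑[ k < suc m ] (suc (suc m) Cℚ k * b k)
  recurrence-last-term m b sum≡0 = begin
    fromℕ (suc (suc m)) * b (suc m)         ≡⟨ cong (λ c → fromℕ c * b (suc m)) ([n+1]Cn≡n+1 (suc m)) ⟨
    suc (suc m) Cℚ suc m * b (suc m)        ≡⟨ inverseʳ-unique (∑[ k < suc m ] (suc (suc m) Cℚ k * b k)) _ sum≡0 ⟩
    - ∑[ k < suc m ] (suc (suc m) Cℚ k * b k) ∎

  bernoulliRecurrence⇒≡B : ∀ {b} → BernoulliRecurrence b → ∀ n → b n ≡ B n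
  bernoulliRecurrence⇒≡B {b} (b0≡1 , b-rec) = <-rec (λ n → b n ≡ B n) step
    where
    step : ∀ n → (∀ {k} → k < n → b k ≡ B k) → b n ≡ B n
    step zero    _  = b0≡1
    step (suc m) ih = fromℕ-suc-*-cancelˡ (suc m) (begin
      fromℕ (suc (suc m)) * b (suc m)              ≡⟨ recurrence-last-term m b (b-rec m) ⟩
      - ∑[ k < suc m ] (suc (suc m) Cℚ k * b k)    ≡⟨ cong -_ (∑-cong (suc m) (λ k k<1+m → cong (suc (suc m) Cℚ k *_) (ih k<1+m))) ⟩
      - ∑[ k < suc m ] (suc (suc m) Cℚ k * B k)    ≡⟨ recurrence-last-term m B (B-recurrence m) ⟨
      fromℕ (suc (suc m)) * B (suc m)              ∎)

  -- (−1)ⁿ Bₙ(1); as Bₙ(1) = Bₙ for n ≥ 2, identifying it with Bₙ kills the odd Bₙ.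
  reflectedB : ℕ → ℚ
  reflectedB n = (- 1ℚ) ^ n * ∑[ k < suc n ] (n Cℚ k * B k)

  reflectedB-column : ∀ n j → j < n →
    ∑[ l < n ∸ j ] ((n Cℚ (j ℕ.+ l) * (- 1ℚ) ^ (j ℕ.+ l)) * ((j ℕ.+ l) Cℚ j * B j)) ≡ - (- 1ℚ) ^ n * (n Cℚ j * B j)
  reflectedB-column n j j<n = begin
    ∑[ l < n ∸ j ] ((n Cℚ (j ℕ.+ l) * (- 1ℚ) ^ (j ℕ.+ l)) * ((j ℕ.+ l) Cℚ j * B j))
      ≡⟨ ∑-cong (n ∸ j) (λ l l<n∸j → factor l (j+l≤n l<n∸j)) ⟩
    ∑[ l < n ∸ j ] (c * ((- 1ℚ) ^ l * (n ∸ j) Cℚ l))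
      ≡⟨ *-distribˡ-∑ c (n ∸ j) (λ l → (- 1ℚ) ^ l * (n ∸ j) Cℚ l) ⟨
    c * ∑[ l < n ∸ j ] ((- 1ℚ) ^ l * (n ∸ j) Cℚ l)
      ≡⟨ cong (c *_) alternating ⟩
    c * - (- 1ℚ) ^ (n ∸ j)
      ≡⟨ regroup (n Cℚ j) ((- 1ℚ) ^ j) (B j) ((- 1ℚ) ^ (n ∸ j)) ⟩
    - ((- 1ℚ) ^ j * (- 1ℚ) ^ (n ∸ j)) * (n Cℚ j * B j)
      ≡⟨ cong (λ s → - s * (n Cℚ j * B j)) (trans (sym (^-homo-* (- 1ℚ) j (n ∸ j))) (cong ((- 1ℚ) ^_) (ℕₚ.m+[n∸m]≡n (ℕₚ.<⇒≤ j<n)))) ⟩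
    - (- 1ℚ) ^ n * (n Cℚ j * B j)
      ∎
    where
    c = n Cℚ j * (- 1ℚ) ^ j * B j
    j+l≤n : ∀ {l} → l < n ∸ j → j ℕ.+ l ≤ n
    j+l≤n {l} l<n∸j = subst (j ℕ.+ l ≤_) (ℕₚ.m+[n∸m]≡n (ℕₚ.<⇒≤ j<n)) (ℕₚ.+-monoʳ-≤ j (ℕₚ.<⇒≤ l<n∸j))
    alternating : ∑[ l < n ∸ j ] ((- 1ℚ) ^ l * (n ∸ j) Cℚ l) ≡ - (- 1ℚ) ^ (n ∸ j)
    alternating rewrite ℕₚ.+-∸-assoc 1 j<n = ∑-alternating-binomial (n ∸ suc j)
    regroup : ∀ c s b t → c * s * b * - t ≡ - (s * t) * (c * b)
    regroup = solve-∀ ℚ-ring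
    factor : ∀ l → j ℕ.+ l ≤ n → (n Cℚ (j ℕ.+ l) * (- 1ℚ) ^ (j ℕ.+ l)) * ((j ℕ.+ l) Cℚ j * B j) ≡ c * ((- 1ℚ) ^ l * (n ∸ j) Cℚ l)
    factor l j+l≤n = begin
      (n Cℚ (j ℕ.+ l) * (- 1ℚ) ^ (j ℕ.+ l)) * ((j ℕ.+ l) Cℚ j * B j)
        ≡⟨ pair-binomials (n Cℚ (j ℕ.+ l)) ((- 1ℚ) ^ (j ℕ.+ l)) ((j ℕ.+ l) Cℚ j) (B j) ⟩
      (n Cℚ (j ℕ.+ l) * (j ℕ.+ l) Cℚ j) * (- 1ℚ) ^ (j ℕ.+ l) * B j
        ≡⟨ cong₂ (λ c s → c * s * B j) binomials (^-homo-* (- 1ℚ) j l) ⟩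
      (n Cℚ j * (n ∸ j) Cℚ l) * ((- 1ℚ) ^ j * (- 1ℚ) ^ l) * B j
        ≡⟨ separate (n Cℚ j) ((n ∸ j) Cℚ l) ((- 1ℚ) ^ j) ((- 1ℚ) ^ l) (B j) ⟩
      c * ((- 1ℚ) ^ l * (n ∸ j) Cℚ l)
        ∎
      where
      binomials : n Cℚ (j ℕ.+ l) * (j ℕ.+ l) Cℚ j ≡ n Cℚ j * (n ∸ j) Cℚ l
      binomials = trans (sym (fromℕ-homo-* (n C (j ℕ.+ l)) ((j ℕ.+ l) C j)))
        (trans (cong fromℕ (C-trinomial n j l j+l≤n)) (fromℕ-homo-* (n C j) ((n ∸ j) C l)))
      pair-binomials : ∀ a s c b → (a * s) * (c * b) ≡ (a * c) * s * b
      pair-binomials = solve-∀ ℚ-ring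
      separate : ∀ a c s t b → (a * c) * (s * t) * b ≡ a * s * b * (t * c)
      separate = solve-∀ ℚ-ring

  reflectedB-recurrence : BernoulliRecurrence reflectedB
  reflectedB-recurrence = refl , rec
    where
    rec : ∀ m → ∑[ k < suc (suc m) ] (suc (suc m) Cℚ k * reflectedB k) ≡ 0ℚ
    rec m = begin
      ∑[ k < n ] (n Cℚ k * reflectedB k)
        ≡⟨ ∑-cong n (λ k _ → trans (sym (ℚₚ.*-assoc (n Cℚ k) ((- 1ℚ) ^ k) _)) (*-distribˡ-∑ (n Cℚ k * (- 1ℚ) ^ k) (suc k) (λ j → k Cℚ j * B j))) ⟩
      ∑[ k < n ] ∑[ j < suc k ] ((n Cℚ k * (- 1ℚ) ^ k) * (k Cℚ j * B j))
        ≡⟨ ∑-triangle n (λ k j → (n Cℚ k * (- 1ℚ) ^ k) * (k Cℚ j * B j)) ⟩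
      ∑[ j < n ] ∑[ l < n ∸ j ] ((n Cℚ (j ℕ.+ l) * (- 1ℚ) ^ (j ℕ.+ l)) * ((j ℕ.+ l) Cℚ j * B j))
        ≡⟨ ∑-cong n (reflectedB-column n) ⟩
      ∑[ j < n ] (- (- 1ℚ) ^ n * (n Cℚ j * B j))
        ≡⟨ *-distribˡ-∑ (- (- 1ℚ) ^ n) n (λ j → n Cℚ j * B j) ⟨
      - (- 1ℚ) ^ n * ∑[ j < n ] (n Cℚ j * B j)
        ≡⟨ cong (- (- 1ℚ) ^ n *_) (B-recurrence m) ⟩
      - (- 1ℚ) ^ n * 0ℚ
        ≡⟨ ℚₚ.*-zeroʳ (- (- 1ℚ) ^ n) ⟩
      0ℚ ∎
      where
      n = suc (suc m)

  B-odd : ∀ q → B (suc (suc (suc (q ℕ.+ q)))) ≡ 0ℚ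
  B-odd q = x≡-x⇒x≡0 (begin
    B n                                                     ≡⟨ bernoulliRecurrence⇒≡B {reflectedB} reflectedB-recurrence n ⟨
    (- 1ℚ) ^ n * (∑[ k < n ] (n Cℚ k * B k) + n Cℚ n * B n)  ≡⟨ cong₂ (λ s t → - 1ℚ * (- 1ℚ * (- 1ℚ * s)) * (t + n Cℚ n * B n)) (-1^[n+n]≡1 q) (B-recurrence (suc (q ℕ.+ q))) ⟩
    - 1ℚ * (- 1ℚ * (- 1ℚ * 1ℚ)) * (0ℚ + n Cℚ n * B n)      ≡⟨ cong (λ c → - 1ℚ * (- 1ℚ * (- 1ℚ * 1ℚ)) * (0ℚ + c * B n)) (nCℚn≡1 n) ⟩
    - 1ℚ * (- 1ℚ * (- 1ℚ * 1ℚ)) * (0ℚ + 1ℚ * B n)          ≡⟨ simplify (B n) ⟩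
    - B n                                                   ∎)
    where
    n = suc (suc (suc (q ℕ.+ q)))
    simplify : ∀ y → - 1ℚ * (- 1ℚ * (- 1ℚ * 1ℚ)) * (0ℚ + 1ℚ * y) ≡ - y
    simplify = solve-∀ ℚ-ring

  powerSum : ℕ → ℕ → ℚ
  powerSum k n = ∑[ j < n ] (fromℕ j ^ k)

  -- B₍ₖ₊₁₎(x) − B₍ₖ₊₁₎ for the Bernoulli polynomial B₍ₖ₊₁₎(x) = ∑ᵢ C(k+1,i) Bᵢ x^(k+1−i).
  faulhaberPolynomial : ℕ → ℚ → ℚ
  faulhaberPolynomial k x = ∑[ i < suc k ] (suc k Cℚ i * B i * x ^ (suc k ∸ i))

  ∑-binomial-B-vanishes : ∀ {K j} → suc j < K → ∑[ i < K ∸ j ] ((K ∸ j) Cℚ i * B i) ≡ 0ℚ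
  ∑-binomial-B-vanishes {K} {j} 1+j<K rewrite ℕₚ.+-∸-assoc 1 (ℕₚ.<⇒≤ 1+j<K) | ℕₚ.+-∸-assoc 1 1+j<K =
    B-recurrence (K ∸ suc (suc j))

  bernoulli-binomial-sum : ∀ k x →
    ∑[ i < suc k ] (suc k Cℚ i * B i * ∑[ j < suc k ∸ i ] ((suc k ∸ i) Cℚ j * x ^ j)) ≡ fromℕ (suc k) * x ^ k
  bernoulli-binomial-sum k x = begin
    ∑[ i < K ] (a i * ∑[ j < K ∸ i ] ((K ∸ i) Cℚ j * x ^ j))
      ≡⟨ ∑-cong K (λ i _ → *-distribˡ-∑ (a i) (K ∸ i) (λ j → (K ∸ i) Cℚ j * x ^ j)) ⟩
    ∑[ i < K ] ∑[ j < K ∸ i ] (a i * ((K ∸ i) Cℚ j * x ^ j))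
      ≡⟨ ∑-swap-triangle K (λ i j → a i * ((K ∸ i) Cℚ j * x ^ j)) ⟩
    ∑[ j < K ] ∑[ i < K ∸ j ] (a i * ((K ∸ i) Cℚ j * x ^ j))
      ≡⟨ ∑-cong K (λ j j<K → trans (∑-cong (K ∸ j) (λ i i< → swap-binomials i j (i+j≤K j i (ℕₚ.<⇒≤ j<K) i<)))
                                   (sym (*-distribˡ-∑ (K Cℚ j * x ^ j) (K ∸ j) (λ i → (K ∸ j) Cℚ i * B i)))) ⟩
    ∑[ j < k ] ((K Cℚ j * x ^ j) * T j) + (K Cℚ k * x ^ k) * T k
      ≡⟨ cong₂ _+_ (∑-zero k (λ j j<k → trans (cong (K Cℚ j * x ^ j *_) (∑-binomial-B-vanishes (s≤s j<k))) (ℚₚ.*-zeroʳ (K Cℚ j * x ^ j))))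
                   (cong₂ (λ c t → (fromℕ c * x ^ k) * t) ([n+1]Cn≡n+1 k) T[k]≡1) ⟩
    0ℚ + (fromℕ K * x ^ k) * 1ℚ
      ≡⟨ trans (ℚₚ.+-identityˡ _) (ℚₚ.*-identityʳ (fromℕ K * x ^ k)) ⟩
    fromℕ K * x ^ k
      ∎
    where
    K = suc k
    a : ℕ → ℚ
    a i = K Cℚ i * B i
    T : ℕ → ℚ
    T j = ∑[ i < K ∸ j ] ((K ∸ j) Cℚ i * B i)
    T[k]≡1 : T k ≡ 1ℚ
    T[k]≡1 rewrite ℕₚ.m+n∸n≡m 1 k = refl
    i+j≤K : ∀ j i → j ≤ K → i < K ∸ j → i ℕ.+ j ≤ K
    i+j≤K j i j≤K i<K∸j = subst (i ℕ.+ j ≤_) (ℕₚ.m∸n+n≡m j≤K) (ℕₚ.+-monoˡ-≤ j (ℕₚ.<⇒≤ i<K∸j))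
    swap-binomials : ∀ i j → i ℕ.+ j ≤ K → a i * ((K ∸ i) Cℚ j * x ^ j) ≡ (K Cℚ j * x ^ j) * ((K ∸ j) Cℚ i * B i)
    swap-binomials i j i+j≤K = begin
      K Cℚ i * B i * ((K ∸ i) Cℚ j * x ^ j)         ≡⟨ pair (K Cℚ i) (B i) ((K ∸ i) Cℚ j) (x ^ j) ⟩
      (K Cℚ i * (K ∸ i) Cℚ j) * (B i * x ^ j)       ≡⟨ cong (_* (B i * x ^ j)) binomials ⟩
      (K Cℚ j * (K ∸ j) Cℚ i) * (B i * x ^ j)       ≡⟨ unpair (K Cℚ j) ((K ∸ j) Cℚ i) (B i) (x ^ j) ⟩
      (K Cℚ j * x ^ j) * ((K ∸ j) Cℚ i * B i)       ∎
      where
      binomials : K Cℚ i * (K ∸ i) Cℚ j ≡ K Cℚ j * (K ∸ j) Cℚ i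
      binomials = trans (sym (fromℕ-homo-* (K C i) ((K ∸ i) C j)))
        (trans (cong fromℕ (C-swap K i j i+j≤K)) (fromℕ-homo-* (K C j) ((K ∸ j) C i)))
      pair : ∀ c b c′ y → c * b * (c′ * y) ≡ (c * c′) * (b * y)
      pair = solve-∀ ℚ-ring
      unpair : ∀ c c′ b y → (c * c′) * (b * y) ≡ (c * y) * (c′ * b)
      unpair = solve-∀ ℚ-ring

  faulhaberPolynomial-step : ∀ k x → faulhaberPolynomial k (x + 1ℚ) ≡ faulhaberPolynomial k x + fromℕ (suc k) * x ^ k
  faulhaberPolynomial-step k x = begin
    ∑[ i < K ] (a i * (x + 1ℚ) ^ (K ∸ i))
      ≡⟨ ∑-cong K (λ i _ → trans (cong (a i *_) (binomial-split-last x (K ∸ i))) (ℚₚ.*-distribˡ-+ (a i) (lower i) (x ^ (K ∸ i)))) ⟩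
    ∑[ i < K ] (a i * lower i + a i * x ^ (K ∸ i))
      ≡⟨ ∑-distrib-+ K (λ i → a i * lower i) (λ i → a i * x ^ (K ∸ i)) ⟩
    ∑[ i < K ] (a i * lower i) + faulhaberPolynomial k x
      ≡⟨ cong (_+ faulhaberPolynomial k x) (bernoulli-binomial-sum k x) ⟩
    fromℕ K * x ^ k + faulhaberPolynomial k x
      ≡⟨ ℚₚ.+-comm (fromℕ K * x ^ k) (faulhaberPolynomial k x) ⟩
    faulhaberPolynomial k x + fromℕ K * x ^ k
      ∎
    where
    K = suc k
    a : ℕ → ℚ
    a i = K Cℚ i * B i
    lower : ℕ → ℚ
    lower i = ∑[ j < K ∸ i ] ((K ∸ i) Cℚ j * x ^ j)

  faulhaber : ∀ k n → fromℕ (suc k) * powerSum k n ≡ faulhaberPolynomial k (fromℕ n)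
  faulhaber k zero    = trans (ℚₚ.*-zeroʳ (fromℕ (suc k))) (sym (∑-zero (suc k) zero-term))
    where
    zero-term : ∀ i → i < suc k → suc k Cℚ i * B i * 0ℚ ^ (suc k ∸ i) ≡ 0ℚ
    zero-term i i≤k = begin
      suc k Cℚ i * B i * 0ℚ ^ (suc k ∸ i)    ≡⟨ cong (λ e → suc k Cℚ i * B i * 0ℚ ^ e) (ℕₚ.+-∸-assoc 1 (ℕₚ.≤-pred i≤k)) ⟩
      suc k Cℚ i * B i * (0ℚ * 0ℚ ^ (k ∸ i)) ≡⟨ cong (suc k Cℚ i * B i *_) (ℚₚ.*-zeroˡ (0ℚ ^ (k ∸ i))) ⟩
      suc k Cℚ i * B i * 0ℚ                  ≡⟨ ℚₚ.*-zeroʳ (suc k Cℚ i * B i) ⟩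
      0ℚ                                     ∎
  faulhaber k (suc n) = begin
    fromℕ (suc k) * (powerSum k n + fromℕ n ^ k)                ≡⟨ ℚₚ.*-distribˡ-+ (fromℕ (suc k)) (powerSum k n) (fromℕ n ^ k) ⟩
    fromℕ (suc k) * powerSum k n + fromℕ (suc k) * fromℕ n ^ k  ≡⟨ cong (_+ fromℕ (suc k) * fromℕ n ^ k) (faulhaber k n) ⟩
    faulhaberPolynomial k (fromℕ n) + fromℕ (suc k) * fromℕ n ^ k ≡⟨ faulhaberPolynomial-step k (fromℕ n) ⟨
    faulhaberPolynomial k (fromℕ n + 1ℚ)                         ≡⟨ cong (faulhaberPolynomial k) (fromℕ-suc n) ⟨
    faulhaberPolynomial k (fromℕ (suc n))                        ∎

  faulhaber-remainder : ∀ k n → fromℕ (suc k) * (fromℕ n * B k - powerSum k n) ≡ - ∑[ i < k ] (suc k Cℚ i * B i * fromℕ n ^ (suc k ∸ i))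
  faulhaber-remainder k n = begin
    fromℕ (suc k) * (fromℕ n * B k - powerSum k n)
      ≡⟨ expand (fromℕ (suc k)) (fromℕ n) (B k) (powerSum k n) ⟩
    fromℕ (suc k) * B k * fromℕ n - fromℕ (suc k) * powerSum k n
      ≡⟨ cong (λ s → fromℕ (suc k) * B k * fromℕ n - s) (faulhaber k n) ⟩
    fromℕ (suc k) * B k * fromℕ n - (lower + suc k Cℚ k * B k * fromℕ n ^ (suc k ∸ k))
      ≡⟨ cong₂ (λ c e → fromℕ (suc k) * B k * fromℕ n - (lower + fromℕ c * B k * fromℕ n ^ e)) ([n+1]Cn≡n+1 k) (ℕₚ.m+n∸n≡m 1 k) ⟩
    fromℕ (suc k) * B k * fromℕ n - (lower + fromℕ (suc k) * B k * (fromℕ n * 1ℚ))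
      ≡⟨ cancel lower (fromℕ (suc k) * B k) (fromℕ n) ⟩
    - lower
      ∎
    where
    lower = ∑[ i < k ] (suc k Cℚ i * B i * fromℕ n ^ (suc k ∸ i))
    expand : ∀ K N b s → K * (N * b - s) ≡ K * b * N - K * s
    expand = solve-∀ ℚ-ring
    cancel : ∀ r c N → c * N - (r + c * (N * 1ℚ)) ≡ - r
    cancel = solve-∀ ℚ-ring

module FiniteDifferences where
  open import Data.Rational using (_*_)
  open Rationals
  open Sums
  open Binomials

  -- (−1)ⁿ times the n-th forward difference of x ↦ xᵐ at 0.
  finiteDifference : ℕ → ℕ → ℚ
  finiteDifference n m = ∑[ k < suc n ] ((- 1ℚ) ^ k * n Cℚ k * fromℕ k ^ m)

  shiftedDifference : ℕ → ℕ → ℚ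
  shiftedDifference n m = ∑[ k < suc n ] ((- 1ℚ) ^ k * n Cℚ k * fromℕ (suc k) ^ m)

  shiftedDifference-binomial : ∀ n m →
    shiftedDifference n m ≡ ∑[ i < m ] (m Cℚ i * finiteDifference n i) + finiteDifference n m
  shiftedDifference-binomial n m = begin
    shiftedDifference n m
      ≡⟨ ∑-cong (suc n) (λ k _ → trans (cong (λ y → (- 1ℚ) ^ k * n Cℚ k * y ^ m) (fromℕ-suc k))
           (trans (cong ((- 1ℚ) ^ k * n Cℚ k *_) (binomial (fromℕ k) m)) (*-distribˡ-∑ ((- 1ℚ) ^ k * n Cℚ k) (suc m) _))) ⟩
    ∑[ k < suc n ] ∑[ i < suc m ] ((- 1ℚ) ^ k * n Cℚ k * (m Cℚ i * fromℕ k ^ i))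
      ≡⟨ ∑-swap (suc m) (suc n) (λ k i → (- 1ℚ) ^ k * n Cℚ k * (m Cℚ i * fromℕ k ^ i)) ⟩
    ∑[ i < suc m ] ∑[ k < suc n ] ((- 1ℚ) ^ k * n Cℚ k * (m Cℚ i * fromℕ k ^ i))
      ≡⟨ ∑-cong (suc m) (λ i _ → trans (∑-cong (suc n) (λ k _ → pull-out ((- 1ℚ) ^ k) (n Cℚ k) (m Cℚ i) (fromℕ k ^ i)))
                                       (sym (*-distribˡ-∑ (m Cℚ i) (suc n) (λ k → (- 1ℚ) ^ k * n Cℚ k * fromℕ k ^ i)))) ⟩
    ∑[ i < m ] (m Cℚ i * finiteDifference n i) + m Cℚ m * finiteDifference n m
      ≡⟨ cong (λ c → ∑[ i < m ] (m Cℚ i * finiteDifference n i) + c * finiteDifference n m) (nCℚn≡1 m) ⟩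
    ∑[ i < m ] (m Cℚ i * finiteDifference n i) + 1ℚ * finiteDifference n m
      ≡⟨ cong (∑[ i < m ] (m Cℚ i * finiteDifference n i) +_) (ℚₚ.*-identityˡ (finiteDifference n m)) ⟩
    ∑[ i < m ] (m Cℚ i * finiteDifference n i) + finiteDifference n m
      ∎
    where
    pull-out : ∀ s c a w → s * c * (a * w) ≡ a * (s * c * w)
    pull-out = solve-∀ ℚ-ring

  finiteDifference-pascal : ∀ n m → finiteDifference (suc n) m ≡ finiteDifference n m - shiftedDifference n m
  finiteDifference-pascal n m = begin
    finiteDifference (suc n) m
      ≡⟨ ∑-unfoldˡ (suc n) (λ k → (- 1ℚ) ^ k * suc n Cℚ k * fromℕ k ^ m) ⟩
    first + ∑[ k < suc n ] ((- 1ℚ) ^ suc k * suc n Cℚ suc k * fromℕ (suc k) ^ m)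
      ≡⟨ cong (first +_) (∑-cong (suc n) (λ k _ → split k)) ⟩
    first + ∑[ k < suc n ] (- ((- 1ℚ) ^ k * n Cℚ k * fromℕ (suc k) ^ m) + - upper k)
      ≡⟨ cong (first +_) (trans (∑-distrib-+ (suc n) _ (λ k → - upper k)) (cong₂ _+_ (∑-neg (suc n) _) (∑-neg (suc n) upper))) ⟩
    first + (- shiftedDifference n m + - (∑ n upper + (- 1ℚ) ^ n * n Cℚ suc n * fromℕ (suc n) ^ m))
      ≡⟨ cong (λ c → first + (- shiftedDifference n m + - (∑ n upper + (- 1ℚ) ^ n * fromℕ c * fromℕ (suc n) ^ m))) (k>n⇒nCk≡0 (ℕₚ.n<1+n n)) ⟩
    first + (- shiftedDifference n m + - (∑ n upper + (- 1ℚ) ^ n * 0ℚ * fromℕ (suc n) ^ m))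
      ≡⟨ regroup first (shiftedDifference n m) (∑ n upper) ((- 1ℚ) ^ n) (fromℕ (suc n) ^ m) ⟩
    (first + - ∑ n upper) - shiftedDifference n m
      ≡⟨ cong (λ u → (first + u) - shiftedDifference n m) (trans (sym (∑-neg n upper)) (∑-cong n (λ k _ → negate k))) ⟩
    (first + ∑[ k < n ] ((- 1ℚ) ^ suc k * n Cℚ suc k * fromℕ (suc k) ^ m)) - shiftedDifference n m
      ≡⟨ cong (_- shiftedDifference n m) (∑-unfoldˡ n (λ k → (- 1ℚ) ^ k * n Cℚ k * fromℕ k ^ m)) ⟨
    finiteDifference n m - shiftedDifference n m
      ∎
    where
    first = 1ℚ * 1ℚ * fromℕ 0 ^ m
    upper : ℕ → ℚ
    upper k = (- 1ℚ) ^ k * n Cℚ suc k * fromℕ (suc k) ^ m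
    split : ∀ k → (- 1ℚ) ^ suc k * suc n Cℚ suc k * fromℕ (suc k) ^ m ≡ - ((- 1ℚ) ^ k * n Cℚ k * fromℕ (suc k) ^ m) + - upper k
    split k = trans (cong (λ c → (- 1ℚ) ^ suc k * c * fromℕ (suc k) ^ m) (Cℚ-pascal n k))
                    (distribute ((- 1ℚ) ^ k) (n Cℚ k) (n Cℚ suc k) (fromℕ (suc k) ^ m))
      where
      distribute : ∀ s a b w → - 1ℚ * s * (a + b) * w ≡ - (s * a * w) + - (s * b * w)
      distribute = solve-∀ ℚ-ring
    regroup : ∀ z t u s w → z + (- t + - (u + s * 0ℚ * w)) ≡ (z + - u) - t
    regroup = solve-∀ ℚ-ring
    negate : ∀ k → - upper k ≡ (- 1ℚ) ^ suc k * n Cℚ suc k * fromℕ (suc k) ^ m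
    negate k = sign-in ((- 1ℚ) ^ k) (n Cℚ suc k) (fromℕ (suc k) ^ m)
      where
      sign-in : ∀ s c w → - (s * c * w) ≡ - 1ℚ * s * c * w
      sign-in = solve-∀ ℚ-ring

  finiteDifference-suc : ∀ n m → finiteDifference (suc n) m ≡ - ∑[ i < m ] (m Cℚ i * finiteDifference n i)
  finiteDifference-suc n m = begin
    finiteDifference (suc n) m
      ≡⟨ finiteDifference-pascal n m ⟩
    finiteDifference n m - shiftedDifference n m
      ≡⟨ cong (λ s → finiteDifference n m - s) (shiftedDifference-binomial n m) ⟩
    finiteDifference n m - (∑[ i < m ] (m Cℚ i * finiteDifference n i) + finiteDifference n m)
      ≡⟨ cancel (finiteDifference n m) (∑[ i < m ] (m Cℚ i * finiteDifference n i)) ⟩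
    - ∑[ i < m ] (m Cℚ i * finiteDifference n i)
      ∎
    where
    cancel : ∀ x y → x - (y + x) ≡ - y
    cancel = solve-∀ ℚ-ring

  finiteDifference-below : ∀ n m → m < n → finiteDifference n m ≡ 0ℚ
  finiteDifference-below (suc n) m m≤n = trans (finiteDifference-suc n m)
    (cong -_ (∑-zero m (λ i i<m → trans (cong (m Cℚ i *_) (finiteDifference-below n i (ℕₚ.<-≤-trans i<m (ℕₚ.≤-pred m≤n))))
                                        (ℚₚ.*-zeroʳ (m Cℚ i)))))

  finiteDifference-diagonal : ∀ n → finiteDifference n n ≡ (- 1ℚ) ^ n * fromℕ (n !)
  finiteDifference-diagonal zero    = refl
  finiteDifference-diagonal (suc n) = begin
    finiteDifference (suc n) (suc n)
      ≡⟨ finiteDifference-suc n (suc n) ⟩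
    - (∑[ i < n ] (suc n Cℚ i * finiteDifference n i) + suc n Cℚ n * finiteDifference n n)
      ≡⟨ cong₂ (λ s c → - (s + fromℕ c * finiteDifference n n))
           (∑-zero n (λ i i<n → trans (cong (suc n Cℚ i *_) (finiteDifference-below n i i<n)) (ℚₚ.*-zeroʳ (suc n Cℚ i))))
           ([n+1]Cn≡n+1 n) ⟩
    - (0ℚ + fromℕ (suc n) * finiteDifference n n)
      ≡⟨ cong (λ d → - (0ℚ + fromℕ (suc n) * d)) (finiteDifference-diagonal n) ⟩
    - (0ℚ + fromℕ (suc n) * ((- 1ℚ) ^ n * fromℕ (n !)))
      ≡⟨ regroup (fromℕ (suc n)) ((- 1ℚ) ^ n) (fromℕ (n !)) ⟩
    - 1ℚ * (- 1ℚ) ^ n * (fromℕ (suc n) * fromℕ (n !))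
      ≡⟨ cong (- 1ℚ * (- 1ℚ) ^ n *_) (fromℕ-homo-* (suc n) (n !)) ⟨
    (- 1ℚ) ^ suc n * fromℕ (suc n !)
      ∎
    where
    regroup : ∀ a s f → - (0ℚ + a * (s * f)) ≡ - 1ℚ * s * (a * f)
    regroup = solve-∀ ℚ-ring

module PAdic {p : ℕ} (p-prime : Prime p) where
  open import Data.Rational using (_*_)
  open Rationals
  open Sums
  open Binomials
  open Bernoulli

  private instance
    p≢0 : ℕ.NonZero p
    p≢0 = prime⇒nonZero p-prime

  P : ℚ
  P = fromℕ p

  -- x = a pᵉ / u with p ∤ u, i.e. the p-adic valuation of x is at least e.
  record _≤ᵥ_ (e : ℕ) (x : ℚ) : Set where
    constructor mk≤ᵥ
    field
      numerator           : ℤ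
      unit                : ℕ
      p∤unit              : ¬ p ∣ unit
      x*unit≡numerator*pᵉ : x * fromℕ unit ≡ fromℤ numerator * P ^ e

  infix 4 _≤ᵥ_

  p∤1 : ¬ p ∣ 1
  p∤1 p∣1 = ¬prime[1] (subst Prime (∣1⇒≡1 p∣1) p-prime)

  p∤* : ∀ {m n} → ¬ p ∣ m → ¬ p ∣ n → ¬ p ∣ m ℕ.* n
  p∤* {m} {n} p∤m p∤n p∣mn = [ p∤m , p∤n ]′ (euclidsLemma m n p-prime p∣mn)

  ≤ᵥ-fromℤ*pᵉ : ∀ a e → e ≤ᵥ fromℤ a * P ^ e
  ≤ᵥ-fromℤ*pᵉ a e = mk≤ᵥ a 1 p∤1 (ℚₚ.*-identityʳ _)

  ≤ᵥ-0ℚ : ∀ e → e ≤ᵥ 0ℚ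
  ≤ᵥ-0ℚ e = subst (e ≤ᵥ_) (ℚₚ.*-zeroˡ (P ^ e)) (≤ᵥ-fromℤ*pᵉ (ℤ.+ 0) e)

  ≤ᵥ-pᵉ : ∀ e → e ≤ᵥ P ^ e
  ≤ᵥ-pᵉ e = subst (e ≤ᵥ_) (ℚₚ.*-identityˡ (P ^ e)) (≤ᵥ-fromℤ*pᵉ (ℤ.+ 1) e)

  ≤ᵥ-fromℤ : ∀ a → 0 ≤ᵥ fromℤ a
  ≤ᵥ-fromℤ a = subst (0 ≤ᵥ_) (ℚₚ.*-identityʳ (fromℤ a)) (≤ᵥ-fromℤ*pᵉ a 0)

  ≤ᵥ-fromℕ : ∀ n → 0 ≤ᵥ fromℕ n
  ≤ᵥ-fromℕ n = ≤ᵥ-fromℤ (ℤ.+ n)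

  ≤ᵥ-multiple : ∀ {c} → p ∣ c → 1 ≤ᵥ fromℕ c
  ≤ᵥ-multiple (divides q refl) = subst (1 ≤ᵥ_) (sym (trans (fromℕ-homo-* q p) (cong (fromℕ q *_) (sym (ℚₚ.*-identityʳ P)))))
    (≤ᵥ-fromℤ*pᵉ (ℤ.+ q) 1)

  ≤ᵥ-+ : ∀ {e x y} → e ≤ᵥ x → e ≤ᵥ y → e ≤ᵥ x + y
  ≤ᵥ-+ {e} {x} {y} (mk≤ᵥ a u p∤u x≡) (mk≤ᵥ b v p∤v y≡) =
    mk≤ᵥ (a ℤ.* ℤ.+ v ℤ.+ b ℤ.* ℤ.+ u) (u ℕ.* v) (p∤* p∤u p∤v) (begin
      (x + y) * fromℕ (u ℕ.* v)                            ≡⟨ cong ((x + y) *_) (fromℕ-homo-* u v) ⟩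
      (x + y) * (fromℕ u * fromℕ v)                        ≡⟨ cross x y (fromℕ u) (fromℕ v) ⟩
      (x * fromℕ u) * fromℕ v + (y * fromℕ v) * fromℕ u    ≡⟨ cong₂ (λ s t → s * fromℕ v + t * fromℕ u) x≡ y≡ ⟩
      (fromℤ a * P ^ e) * fromℕ v + (fromℤ b * P ^ e) * fromℕ u ≡⟨ collect (fromℤ a) (fromℤ b) (fromℕ u) (fromℕ v) (P ^ e) ⟩
      (fromℤ a * fromℕ v + fromℤ b * fromℕ u) * P ^ e     ≡⟨ cong (_* P ^ e) numerators ⟨
      fromℤ (a ℤ.* ℤ.+ v ℤ.+ b ℤ.* ℤ.+ u) * P ^ e          ∎)
    where
    cross : ∀ x y u v → (x + y) * (u * v) ≡ (x * u) * v + (y * v) * u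
    cross = solve-∀ ℚ-ring
    collect : ∀ a b u v w → (a * w) * v + (b * w) * u ≡ (a * v + b * u) * w
    collect = solve-∀ ℚ-ring
    numerators : fromℤ (a ℤ.* ℤ.+ v ℤ.+ b ℤ.* ℤ.+ u) ≡ fromℤ a * fromℕ v + fromℤ b * fromℕ u
    numerators = trans (fromℤ-homo-+ (a ℤ.* ℤ.+ v) (b ℤ.* ℤ.+ u)) (cong₂ _+_ (fromℤ-homo-* a (ℤ.+ v)) (fromℤ-homo-* b (ℤ.+ u)))

  ≤ᵥ-* : ∀ {e f x y} → e ≤ᵥ x → f ≤ᵥ y → e ℕ.+ f ≤ᵥ x * y
  ≤ᵥ-* {e} {f} {x} {y} (mk≤ᵥ a u p∤u x≡) (mk≤ᵥ b v p∤v y≡) =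
    mk≤ᵥ (a ℤ.* b) (u ℕ.* v) (p∤* p∤u p∤v) (begin
      (x * y) * fromℕ (u ℕ.* v)                   ≡⟨ cong ((x * y) *_) (fromℕ-homo-* u v) ⟩
      (x * y) * (fromℕ u * fromℕ v)               ≡⟨ interchange x y (fromℕ u) (fromℕ v) ⟩
      (x * fromℕ u) * (y * fromℕ v)               ≡⟨ cong₂ _*_ x≡ y≡ ⟩
      (fromℤ a * P ^ e) * (fromℤ b * P ^ f)       ≡⟨ interchange (fromℤ a) (P ^ e) (fromℤ b) (P ^ f) ⟩
      (fromℤ a * fromℤ b) * (P ^ e * P ^ f)       ≡⟨ cong₂ _*_ (fromℤ-homo-* a b) (^-homo-* P e f) ⟨
      fromℤ (a ℤ.* b) * P ^ (e ℕ.+ f)             ∎)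
    where
    interchange : ∀ x y u v → (x * y) * (u * v) ≡ (x * u) * (y * v)
    interchange = solve-∀ ℚ-ring

  ≤ᵥ-neg : ∀ {e x} → e ≤ᵥ x → e ≤ᵥ - x
  ≤ᵥ-neg {e} {x} (mk≤ᵥ a u p∤u x≡) =
    mk≤ᵥ (ℤ.- a) u p∤u (begin
      - x * fromℕ u          ≡⟨ ℚₚ.neg-distribˡ-* x (fromℕ u) ⟨
      - (x * fromℕ u)        ≡⟨ cong -_ x≡ ⟩
      - (fromℤ a * P ^ e)    ≡⟨ ℚₚ.neg-distribˡ-* (fromℤ a) (P ^ e) ⟩
      - fromℤ a * P ^ e      ≡⟨ cong (_* P ^ e) (fromℤ-homo‿- a) ⟨
      fromℤ (ℤ.- a) * P ^ e  ∎)

  ≤ᵥ-- : ∀ {e x y} → e ≤ᵥ x → e ≤ᵥ y → e ≤ᵥ x - y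
  ≤ᵥ-- e≤x e≤y = ≤ᵥ-+ e≤x (≤ᵥ-neg e≤y)

  ≤ᵥ-weaken : ∀ {e f x} → e ≤ f → f ≤ᵥ x → e ≤ᵥ x
  ≤ᵥ-weaken {e} {f} {x} e≤f f≤x = lower (f ∸ e) (subst (_≤ᵥ x) (sym (ℕₚ.m∸n+n≡m e≤f)) f≤x)
    where
    lower : ∀ k → k ℕ.+ e ≤ᵥ x → e ≤ᵥ x
    lower zero    k+e≤x = k+e≤x
    lower (suc k) (mk≤ᵥ a u p∤u x≡) =
      lower k (mk≤ᵥ (a ℤ.* ℤ.+ p) u p∤u
        (trans x≡ (trans (shift (fromℤ a) P (P ^ (k ℕ.+ e))) (cong (_* P ^ (k ℕ.+ e)) (sym (fromℤ-homo-* a (ℤ.+ p)))))))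
      where
      shift : ∀ a P w → a * (P * w) ≡ (a * P) * w
      shift = solve-∀ ℚ-ring

  ≤ᵥ-∑ : ∀ {e} n f → (∀ i → i < n → e ≤ᵥ f i) → e ≤ᵥ ∑ n f
  ≤ᵥ-∑ zero    f e≤f = ≤ᵥ-0ℚ _
  ≤ᵥ-∑ (suc n) f e≤f = ≤ᵥ-+ (≤ᵥ-∑ n f (λ i i<n → e≤f i (ℕₚ.m<n⇒m<1+n i<n))) (e≤f n (ℕₚ.n<1+n n))

  ≤ᵥ-^ : ∀ {x} k → 0 ≤ᵥ x → 0 ≤ᵥ x ^ k
  ≤ᵥ-^ zero    0≤x = ≤ᵥ-fromℕ 1
  ≤ᵥ-^ (suc k) 0≤x = ≤ᵥ-* 0≤x (≤ᵥ-^ k 0≤x)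

  ≤ᵥ-cancel-unit : ∀ {e x} n → ¬ p ∣ n → e ≤ᵥ fromℕ n * x → e ≤ᵥ x
  ≤ᵥ-cancel-unit {e} {x} n p∤n (mk≤ᵥ a u p∤u x≡) =
    mk≤ᵥ a (n ℕ.* u) (p∤* p∤n p∤u) (trans (cong (x *_) (fromℕ-homo-* n u)) (trans (regroup x (fromℕ n) (fromℕ u)) x≡))
    where
    regroup : ∀ x n u → x * (n * u) ≡ (n * x) * u
    regroup = solve-∀ ℚ-ring

  P-*-cancelˡ : ∀ {x y} → P * x ≡ P * y → x ≡ y
  P-*-cancelˡ {x} {y} = fromℕ-suc-*-cancelˡ (ℕ.pred p) ∘ subst (λ m → fromℕ m * x ≡ fromℕ m * y) (sym (ℕₚ.suc-pred p))

  ≤ᵥ-cancel-p : ∀ {e x} → suc e ≤ᵥ P * x → e ≤ᵥ x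
  ≤ᵥ-cancel-p {e} {x} (mk≤ᵥ a u p∤u x≡) =
    mk≤ᵥ a u p∤u (P-*-cancelˡ (trans (sym (ℚₚ.*-assoc P x (fromℕ u))) (trans x≡ (regroup (fromℤ a) P (P ^ e)))))
    where
    regroup : ∀ a P w → a * (P * w) ≡ P * (a * w)
    regroup = solve-∀ ℚ-ring

  pᵉ∣c*u⇒pᵉ∣c : ∀ e c u → ¬ p ∣ u → p ℕ.^ e ∣ c ℕ.* u → p ℕ.^ e ∣ c
  pᵉ∣c*u⇒pᵉ∣c zero    c u p∤u _ = 1∣ c
  pᵉ∣c*u⇒pᵉ∣c (suc e) c u p∤u pᵉ⁺¹∣cu with euclidsLemma c u p-prime (∣-trans (m∣m*n (p ℕ.^ e)) pᵉ⁺¹∣cu)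
  ... | inj₂ p∣u = ⊥-elim (p∤u p∣u)
  ... | inj₁ (divides q refl) = subst (_∣ q ℕ.* p) (ℕₚ.*-comm (p ℕ.^ e) p)
          (*-monoˡ-∣ p (pᵉ∣c*u⇒pᵉ∣c e q u p∤u (*-cancelˡ-∣ p (subst (p ℕ.* p ℕ.^ e ∣_) (regroup q p u) pᵉ⁺¹∣cu))))
    where
    regroup : ∀ q p u → q ℕ.* p ℕ.* u ≡ p ℕ.* (q ℕ.* u)
    regroup = ℕ-Solver.solve-∀

  ≤ᵥ-fromℕ⇒∣ : ∀ e c → e ≤ᵥ fromℕ c → p ℕ.^ e ∣ c
  ≤ᵥ-fromℕ⇒∣ e c (mk≤ᵥ a u p∤u c≡) =
    pᵉ∣c*u⇒pᵉ∣c e c u p∤u (divides ℤ.∣ a ∣ (begin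
      c ℕ.* u                                 ≡⟨ ℤₚ.abs-* (ℤ.+ c) (ℤ.+ u) ⟨
      ℤ.∣ ℤ.+ c ℤ.* ℤ.+ u ∣                   ≡⟨ cong ℤ.∣_∣ integral ⟩
      ℤ.∣ a ℤ.* ℤ.+ (p ℕ.^ e) ∣               ≡⟨ ℤₚ.abs-* a (ℤ.+ (p ℕ.^ e)) ⟩
      ℤ.∣ a ∣ ℕ.* p ℕ.^ e                      ∎))
    where
    integral : ℤ.+ c ℤ.* ℤ.+ u ≡ a ℤ.* ℤ.+ (p ℕ.^ e)
    integral = fromℤ-injective (begin
      fromℤ (ℤ.+ c ℤ.* ℤ.+ u)        ≡⟨ fromℤ-homo-* (ℤ.+ c) (ℤ.+ u) ⟩
      fromℕ c * fromℕ u              ≡⟨ c≡ ⟩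
      fromℤ a * P ^ e                ≡⟨ cong (fromℤ a *_) (fromℕ-homo-^ p e) ⟨
      fromℤ a * fromℕ (p ℕ.^ e)      ≡⟨ fromℤ-homo-* a (ℤ.+ (p ℕ.^ e)) ⟨
      fromℤ (a ℤ.* ℤ.+ (p ℕ.^ e))    ∎)

  fromℤ↥≡x*↧ : ∀ x → fromℤ (↥ x) ≡ x * fromℕ (↧ₙ x)
  fromℤ↥≡x*↧ x@(mkℚ n d _) = ℚₚ.toℚᵘ-injective (ℚᵘₚ.≃-sym (ℚᵘₚ.≃-trans (ℚₚ.toℚᵘ-homo-* x (fromℕ (suc d)))
    (ℚᵘ.*≡* (trans (ℤₚ.*-identityʳ _) (cong (λ m → n ℤ.* ℤ.+ m) (sym (ℕₚ.*-identityʳ (suc d))))))))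

  ≤ᵥ-cross : ∀ {e x} (e≤x : e ≤ᵥ x) → ℤ.∣ ↥ x ∣ ℕ.* _≤ᵥ_.unit e≤x ≡ ℤ.∣ _≤ᵥ_.numerator e≤x ∣ ℕ.* p ℕ.^ e ℕ.* ↧ₙ x
  ≤ᵥ-cross {e} {x} (mk≤ᵥ a u _ x≡) = begin
    ℤ.∣ ↥ x ∣ ℕ.* u                            ≡⟨ ℤₚ.abs-* (↥ x) (ℤ.+ u) ⟨
    ℤ.∣ ↥ x ℤ.* ℤ.+ u ∣                        ≡⟨ cong ℤ.∣_∣ integral ⟩
    ℤ.∣ a ℤ.* ℤ.+ (p ℕ.^ e) ℤ.* ℤ.+ ↧ₙ x ∣     ≡⟨ ℤₚ.abs-* (a ℤ.* ℤ.+ (p ℕ.^ e)) (ℤ.+ ↧ₙ x) ⟩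
    ℤ.∣ a ℤ.* ℤ.+ (p ℕ.^ e) ∣ ℕ.* ↧ₙ x        ≡⟨ cong (ℕ._* ↧ₙ x) (ℤₚ.abs-* a (ℤ.+ (p ℕ.^ e))) ⟩
    ℤ.∣ a ∣ ℕ.* p ℕ.^ e ℕ.* ↧ₙ x               ∎
    where
    integral : ↥ x ℤ.* ℤ.+ u ≡ a ℤ.* ℤ.+ (p ℕ.^ e) ℤ.* ℤ.+ ↧ₙ x
    integral = fromℤ-injective (begin
      fromℤ (↥ x ℤ.* ℤ.+ u)                          ≡⟨ fromℤ-homo-* (↥ x) (ℤ.+ u) ⟩
      fromℤ (↥ x) * fromℕ u                          ≡⟨ cong (_* fromℕ u) (fromℤ↥≡x*↧ x) ⟩
      x * fromℕ (↧ₙ x) * fromℕ u                     ≡⟨ swap x (fromℕ (↧ₙ x)) (fromℕ u) ⟩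
      x * fromℕ u * fromℕ (↧ₙ x)                     ≡⟨ cong (_* fromℕ (↧ₙ x)) x≡ ⟩
      fromℤ a * P ^ e * fromℕ (↧ₙ x)                 ≡⟨ cong (λ q → fromℤ a * q * fromℕ (↧ₙ x)) (fromℕ-homo-^ p e) ⟨
      fromℤ a * fromℕ (p ℕ.^ e) * fromℕ (↧ₙ x)       ≡⟨ cong (_* fromℕ (↧ₙ x)) (fromℤ-homo-* a (ℤ.+ (p ℕ.^ e))) ⟨
      fromℤ (a ℤ.* ℤ.+ (p ℕ.^ e)) * fromℕ (↧ₙ x)     ≡⟨ fromℤ-homo-* (a ℤ.* ℤ.+ (p ℕ.^ e)) (ℤ.+ ↧ₙ x) ⟨
      fromℤ (a ℤ.* ℤ.+ (p ℕ.^ e) ℤ.* ℤ.+ ↧ₙ x)       ∎)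
      where
      swap : ∀ x d u → x * d * u ≡ x * u * d
      swap = solve-∀ ℚ-ring

  ≤ᵥ⇒pᵉ∣↥ : ∀ {e x} → e ≤ᵥ x → p ℕ.^ e ∣ ℤ.∣ ↥ x ∣
  ≤ᵥ⇒pᵉ∣↥ {e} {x} e≤x@(mk≤ᵥ a u p∤u _) = pᵉ∣c*u⇒pᵉ∣c e ℤ.∣ ↥ x ∣ u p∤u
    (divides (ℤ.∣ a ∣ ℕ.* ↧ₙ x) (trans (≤ᵥ-cross e≤x) (regroup ℤ.∣ a ∣ (p ℕ.^ e) (↧ₙ x))))
    where
    regroup : ∀ a q d → a ℕ.* q ℕ.* d ≡ a ℕ.* d ℕ.* q
    regroup = ℕ-Solver.solve-∀

  ≤ᵥ⇒p∤↧ : ∀ {e x} → e ≤ᵥ x → ¬ p ∣ ↧ₙ x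
  ≤ᵥ⇒p∤↧ {e} {x@(mkℚ n d n⊥d)} e≤x@(mk≤ᵥ a u p∤u _) p∣↧ =
    [ (λ p∣↥ → ¬prime[1] (subst Prime (recompute n⊥d (p∣↥ , p∣↧)) p-prime)) , p∤u ]′
      (euclidsLemma ℤ.∣ n ∣ u p-prime (∣-trans p∣↧ (divides (ℤ.∣ a ∣ ℕ.* p ℕ.^ e) (≤ᵥ-cross e≤x))))

  2≤ᵥ⇒≡[modp²] : ∀ α β → 2 ≤ᵥ α - β → α ≡ β [modp² p ]
  2≤ᵥ⇒≡[modp²] α β 2≤α-β = subst (_∣ ℤ.∣ ↥ (α - β) ∣) (cong (p ℕ.*_) (ℕₚ.*-identityʳ p)) (≤ᵥ⇒pᵉ∣↥ 2≤α-β) , ≤ᵥ⇒p∤↧ 2≤α-β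

  p∤<p : ∀ {m} → 0 < m → m < p → ¬ p ∣ m
  p∤<p {suc m} _ m<p p∣m = ℕₚ.<⇒≱ m<p (∣⇒≤ p∣m)

  p∤m! : ∀ {m} → m < p → ¬ p ∣ m !
  p∤m! {zero}  _   = p∤1
  p∤m! {suc m} m<p = p∤* (p∤<p (s≤s z≤n) m<p) (p∤m! (ℕₚ.<-trans (ℕₚ.n<1+n m) m<p))

  p∣pCj : ∀ {j} → 0 < j → j < p → p ∣ p C j
  p∣pCj {j} 0<j j<p = [ id , (λ p∣factorials → ⊥-elim (p∤* (p∤m! j<p) (p∤m! p∸j<p) p∣factorials)) ]′
    (euclidsLemma (p C j) (j ! ℕ.* (p ∸ j) !) p-prime (subst (p ∣_) (sym (nCk*[k!*[n∸k]!]≡n! (ℕₚ.<⇒≤ j<p))) p∣p!))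
    where
    p∸j<p : p ∸ j < p
    p∸j<p = ℕₚ.∸-monoʳ-< 0<j (ℕₚ.<⇒≤ j<p)
    p∣p! : p ∣ p !
    p∣p! = subst (λ m → m ∣ m !) (ℕₚ.suc-pred p) (m∣m*n (ℕ.pred p !))

  fermat : ∀ a → 1 ≤ᵥ fromℕ a ^ p - fromℕ a
  fermat zero    = subst (1 ≤ᵥ_) (sym (trans (cong (_- 0ℚ) (0ℚ^n≡0ℚ p)) (ℚₚ.+-identityʳ 0ℚ))) (≤ᵥ-0ℚ 1)
  fermat (suc a) = subst (1 ≤ᵥ_) (sym expansion) (≤ᵥ-+ (fermat a) (≤ᵥ-∑ (ℕ.pred p) middle middle-divisible))
    where
    x = fromℕ a
    middle : ℕ → ℚ
    middle j = p Cℚ suc j * x ^ suc j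
    middle-divisible : ∀ j → j < ℕ.pred p → 1 ≤ᵥ middle j
    middle-divisible j j<p-1 = ≤ᵥ-* (≤ᵥ-multiple (p∣pCj (s≤s z≤n) (subst (suc (suc j) ≤_) (ℕₚ.suc-pred p) (s≤s j<p-1))))
                                      (≤ᵥ-^ (suc j) (≤ᵥ-fromℕ a))
    expansion : fromℕ (suc a) ^ p - fromℕ (suc a) ≡ (x ^ p - x) + ∑ (ℕ.pred p) middle
    expansion = begin
      fromℕ (suc a) ^ p - fromℕ (suc a)
        ≡⟨ cong (λ y → y ^ p - y) (fromℕ-suc a) ⟩
      (x + 1ℚ) ^ p - (x + 1ℚ)
        ≡⟨ cong (_- (x + 1ℚ)) (binomial x p) ⟩
      ∑[ j < p ] (p Cℚ j * x ^ j) + p Cℚ p * x ^ p - (x + 1ℚ)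
        ≡⟨ cong₂ (λ s c → s + c * x ^ p - (x + 1ℚ)) (trans (cong (λ m → ∑[ j < m ] (p Cℚ j * x ^ j)) (sym (ℕₚ.suc-pred p)))
                                                            (∑-unfoldˡ (ℕ.pred p) (λ j → p Cℚ j * x ^ j)))
                                                     (nCℚn≡1 p) ⟩
      1ℚ * 1ℚ + ∑ (ℕ.pred p) middle + 1ℚ * x ^ p - (x + 1ℚ)
        ≡⟨ rearrange (∑ (ℕ.pred p) middle) (x ^ p) x ⟩
      (x ^ p - x) + ∑ (ℕ.pred p) middle
        ∎
      where
      rearrange : ∀ s w x → 1ℚ * 1ℚ + s + 1ℚ * w - (x + 1ℚ) ≡ (w - x) + s
      rearrange = solve-∀ ℚ-ring

  fermat′ : ∀ {a} → ¬ p ∣ a → 1 ≤ᵥ fromℕ a ^ ℕ.pred p - 1ℚ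
  fermat′ {a} p∤a = ≤ᵥ-cancel-unit a p∤a (subst (1 ≤ᵥ_) factor (fermat a))
    where
    x = fromℕ a
    factor : x ^ p - x ≡ x * (x ^ ℕ.pred p - 1ℚ)
    factor = begin
      x ^ p - x                  ≡⟨ cong (λ m → x ^ m - x) (sym (ℕₚ.suc-pred p)) ⟩
      x * x ^ ℕ.pred p - x       ≡⟨ distrib x (x ^ ℕ.pred p) ⟩
      x * (x ^ ℕ.pred p - 1ℚ)    ∎
      where
      distrib : ∀ x w → x * w - x ≡ x * (w - 1ℚ)
      distrib = solve-∀ ℚ-ring

  ≤ᵥ-sign : ∀ k → 0 ≤ᵥ (- 1ℚ) ^ k
  ≤ᵥ-sign k = ≤ᵥ-^ k (≤ᵥ-fromℤ (ℤ.- ℤ.+ 1))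

  -1^j*[p-1]Cj≡1 : ∀ {j} → j ≤ ℕ.pred p → 1 ≤ᵥ (- 1ℚ) ^ j * ℕ.pred p Cℚ j - 1ℚ
  -1^j*[p-1]Cj≡1 {zero}  _       = ≤ᵥ-0ℚ 1
  -1^j*[p-1]Cj≡1 {suc j} j<p-1 = subst (1 ≤ᵥ_) (sym step)
    (≤ᵥ-+ (≤ᵥ-neg (≤ᵥ-* (≤ᵥ-sign j) (≤ᵥ-multiple (p∣pCj (s≤s z≤n) (subst (suc j <_) (ℕₚ.suc-pred p) (s≤s j<p-1))))))
          (-1^j*[p-1]Cj≡1 (ℕₚ.<⇒≤ j<p-1)))
    where
    q = ℕ.pred p
    s = (- 1ℚ) ^ j
    pascal : q Cℚ j + q Cℚ suc j ≡ p Cℚ suc j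
    pascal = trans (sym (Cℚ-pascal q j)) (cong (_Cℚ suc j) (ℕₚ.suc-pred p))
    step : - 1ℚ * s * q Cℚ suc j - 1ℚ ≡ - (s * p Cℚ suc j) + (s * q Cℚ j - 1ℚ)
    step = begin
      - 1ℚ * s * q Cℚ suc j - 1ℚ                             ≡⟨ split s (q Cℚ j) (q Cℚ suc j) ⟩
      - (s * (q Cℚ j + q Cℚ suc j)) + (s * q Cℚ j - 1ℚ)     ≡⟨ cong (λ c → - (s * c) + (s * q Cℚ j - 1ℚ)) pascal ⟩
      - (s * p Cℚ suc j) + (s * q Cℚ j - 1ℚ)                ∎
      where
      split : ∀ s a b → - 1ℚ * s * b - 1ℚ ≡ - (s * (a + b)) + (s * a - 1ℚ)
      split = solve-∀ ℚ-ring

  p∤<2p : ∀ {m} → 0 < m → m < p ℕ.+ p → m ≢ p → ¬ p ∣ m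
  p∤<2p 0<m _     _   (divides zero refl)          = ℕₚ.<-irrefl refl 0<m
  p∤<2p _   _     m≢p (divides (suc zero) refl)    = m≢p (ℕₚ.+-identityʳ p)
  p∤<2p _   m<2p  _   (divides (suc (suc q)) refl) = ℕₚ.<⇒≱ m<2p (ℕₚ.+-monoʳ-≤ p (ℕₚ.m≤m+n p (q ℕ.* p)))

  B-integral : ∀ n → n < ℕ.pred p → 0 ≤ᵥ B n
  B-integral = <-rec (λ n → n < ℕ.pred p → 0 ≤ᵥ B n) step
    where
    step : ∀ n → (∀ {i} → i < n → i < ℕ.pred p → 0 ≤ᵥ B i) → n < ℕ.pred p → 0 ≤ᵥ B n
    step zero    _  _       = ≤ᵥ-fromℕ 1
    step (suc m) ih 1+m<p-1 = ≤ᵥ-cancel-unit (suc (suc m)) (p∤<p (s≤s z≤n) (subst (suc (suc m) <_) (ℕₚ.suc-pred p) (s≤s 1+m<p-1)))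
      (subst (0 ≤ᵥ_) (sym (recurrence-last-term m B (B-recurrence m)))
        (≤ᵥ-neg (≤ᵥ-∑ (suc m) _ (λ i i≤m → ≤ᵥ-* (≤ᵥ-fromℕ (suc (suc m) C i)) (ih i≤m (ℕₚ.<-trans i≤m 1+m<p-1))))))

  p*B-integral : ∀ n → n ≤ ℕ.pred p ℕ.+ ℕ.pred p → 0 ≤ᵥ P * B n
  p*B-integral = <-rec (λ n → n ≤ ℕ.pred p ℕ.+ ℕ.pred p → 0 ≤ᵥ P * B n) step
    where
    step : ∀ n → (∀ {i} → i < n → i ≤ ℕ.pred p ℕ.+ ℕ.pred p → 0 ≤ᵥ P * B i) → n ≤ ℕ.pred p ℕ.+ ℕ.pred p → 0 ≤ᵥ P * B n
    step zero    _  _ = subst (0 ≤ᵥ_) (sym (ℚₚ.*-identityʳ P)) (≤ᵥ-fromℕ p)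
    step (suc m) ih 1+m≤2p-2 with suc (suc m) ℕ.≟ p
    ... | yes m+2≡p = subst (λ c → 0 ≤ᵥ fromℕ c * B (suc m)) m+2≡p
      (subst (0 ≤ᵥ_) (sym (recurrence-last-term m B (B-recurrence m)))
        (≤ᵥ-neg (≤ᵥ-∑ (suc m) _ (λ i i≤m → ≤ᵥ-* (≤ᵥ-fromℕ (suc (suc m) C i)) (B-integral i (subst (i <_) m+1≡p-1 i≤m))))))
      where
      m+1≡p-1 : suc m ≡ ℕ.pred p
      m+1≡p-1 = cong ℕ.pred m+2≡p
    ... | no  m+2≢p = ≤ᵥ-cancel-unit (suc (suc m)) (p∤<2p (s≤s z≤n) m+2<2p m+2≢p)
      (subst (0 ≤ᵥ_) (sym scaled)
        (≤ᵥ-neg (≤ᵥ-∑ (suc m) _ (λ i i≤m → ≤ᵥ-* (≤ᵥ-fromℕ (suc (suc m) C i)) (ih i≤m (ℕₚ.≤-trans (ℕₚ.<⇒≤ i≤m) 1+m≤2p-2))))))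
      where
      m+2<2p : suc (suc m) < p ℕ.+ p
      m+2<2p = subst (suc (suc (suc m)) ≤_) 2+2[p-1]≡2p (s≤s (s≤s 1+m≤2p-2))
        where
        2+2[p-1]≡2p : suc (suc (ℕ.pred p ℕ.+ ℕ.pred p)) ≡ p ℕ.+ p
        2+2[p-1]≡2p = trans (cong suc (sym (ℕₚ.+-suc (ℕ.pred p) (ℕ.pred p)))) (cong₂ ℕ._+_ (ℕₚ.suc-pred p) (ℕₚ.suc-pred p))
      scaled : fromℕ (suc (suc m)) * (P * B (suc m)) ≡ - ∑[ i < suc m ] (suc (suc m) Cℚ i * (P * B i))
      scaled = begin
        fromℕ (suc (suc m)) * (P * B (suc m))              ≡⟨ swap (fromℕ (suc (suc m))) P (B (suc m)) ⟩
        P * (fromℕ (suc (suc m)) * B (suc m))              ≡⟨ cong (P *_) (recurrence-last-term m B (B-recurrence m)) ⟩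
        P * - ∑[ i < suc m ] (suc (suc m) Cℚ i * B i)      ≡⟨ ℚₚ.neg-distribʳ-* P (∑[ i < suc m ] (suc (suc m) Cℚ i * B i)) ⟨
        - (P * ∑[ i < suc m ] (suc (suc m) Cℚ i * B i))    ≡⟨ cong -_ (*-distribˡ-∑ P (suc m) (λ i → suc (suc m) Cℚ i * B i)) ⟩
        - ∑[ i < suc m ] (P * (suc (suc m) Cℚ i * B i))    ≡⟨ cong -_ (∑-cong (suc m) (λ i _ → swap P (suc (suc m) Cℚ i) (B i))) ⟩
        - ∑[ i < suc m ] (suc (suc m) Cℚ i * (P * B i))    ∎
        where
        swap : ∀ a b c → a * (b * c) ≡ b * (a * c)
        swap = solve-∀ ℚ-ring

  ≤ᵥ-^-≡-1 : ∀ {e y} → 0 ≤ᵥ y → e ≤ᵥ y + 1ℚ → ∀ m → e ≤ᵥ y ^ m - (- 1ℚ) ^ m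
  ≤ᵥ-^-≡-1 {e} {y} 0≤y e≤y+1 zero    = subst (e ≤ᵥ_) (sym (ℚₚ.+-inverseʳ 1ℚ)) (≤ᵥ-0ℚ e)
  ≤ᵥ-^-≡-1 {e} {y} 0≤y e≤y+1 (suc m) = subst (e ≤ᵥ_) (sym (step y (y ^ m) ((- 1ℚ) ^ m)))
    (≤ᵥ-+ (≤ᵥ-* 0≤y (≤ᵥ-^-≡-1 0≤y e≤y+1 m)) (≤ᵥ-* (≤ᵥ-sign m) e≤y+1))
    where
    step : ∀ y w s → y * w - - 1ℚ * s ≡ y * (w - s) + s * (y + 1ℚ)
    step = solve-∀ ℚ-ring

  ∏-second-order : ∀ n (t : ℕ → ℚ) → (∀ j → j < n → 1 ≤ᵥ t j) →
    3 ≤ᵥ fromℕ 2 * ∏[ j < n ] (1ℚ + t j) - (fromℕ 2 + fromℕ 2 * ∑ n t + ∑ n t * ∑ n t - ∑[ j < n ] (t j * t j))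
  ∏-second-order zero    t _      = ≤ᵥ-0ℚ 3
  ∏-second-order (suc n) t 1≤t = subst (3 ≤ᵥ_) (sym (step (∏[ j < n ] (1ℚ + t j)) s q (t n)))
    (≤ᵥ-+ (≤ᵥ-* (≤ᵥ-+ (≤ᵥ-fromℕ 1) (≤ᵥ-weaken z≤n tₙ)) (∏-second-order n t 1≤t′))
          (≤ᵥ-- (≤ᵥ-* tₙ (≤ᵥ-* s₁ s₁)) (≤ᵥ-* tₙ q₂)))
    where
    1≤t′ : ∀ j → j < n → 1 ≤ᵥ t j
    1≤t′ j j<n = 1≤t j (ℕₚ.m<n⇒m<1+n j<n)
    tₙ : 1 ≤ᵥ t n
    tₙ = 1≤t n (ℕₚ.n<1+n n)
    s = ∑ n t
    q = ∑[ j < n ] (t j * t j)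
    s₁ : 1 ≤ᵥ s
    s₁ = ≤ᵥ-∑ n t 1≤t′
    q₂ : 2 ≤ᵥ q
    q₂ = ≤ᵥ-∑ n (λ j → t j * t j) (λ j j<n → ≤ᵥ-* (1≤t′ j j<n) (1≤t′ j j<n))
    step : ∀ Π s q t → fromℕ 2 * (Π * (1ℚ + t)) - (fromℕ 2 + fromℕ 2 * (s + t) + (s + t) * (s + t) - (q + t * t))
                     ≡ (1ℚ + t) * (fromℕ 2 * Π - (fromℕ 2 + fromℕ 2 * s + s * s - q)) + (t * (s * s) - t * q)
    step = solve-∀ ℚ-ring

  ∏[1+t]≡1⇒2∑t≡∑t² : ¬ p ∣ 2 → ∀ n (t : ℕ → ℚ) → (∀ j → j < n → 1 ≤ᵥ t j) →
    3 ≤ᵥ ∏[ j < n ] (1ℚ + t j) - 1ℚ → 3 ≤ᵥ fromℕ 2 * ∑ n t - ∑[ j < n ] (t j * t j)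
  ∏[1+t]≡1⇒2∑t≡∑t² p∤2 n t 1≤t 3≤∏-1 = 3≤2S-Q
    where
    S = ∑ n t
    Q = ∑[ j < n ] (t j * t j)
    1≤S : 1 ≤ᵥ S
    1≤S = ≤ᵥ-∑ n t 1≤t
    2≤Q : 2 ≤ᵥ Q
    2≤Q = ≤ᵥ-∑ n (λ j → t j * t j) (λ j j<n → ≤ᵥ-* (1≤t j j<n) (1≤t j j<n))
    3≤2S+S²-Q : 3 ≤ᵥ fromℕ 2 * S + S * S - Q
    3≤2S+S²-Q = subst (3 ≤ᵥ_) (eliminate-∏ (∏[ j < n ] (1ℚ + t j)) S Q)
      (≤ᵥ-- (≤ᵥ-* (≤ᵥ-fromℕ 2) 3≤∏-1) (∏-second-order n t 1≤t))
      where
      eliminate-∏ : ∀ Π S Q → fromℕ 2 * (Π - 1ℚ) - (fromℕ 2 * Π - (fromℕ 2 + fromℕ 2 * S + S * S - Q)) ≡ fromℕ 2 * S + S * S - Q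
      eliminate-∏ = solve-∀ ℚ-ring
    -- p ∤ 2 upgrades S from p ∣ S to p² ∣ S, which makes S² negligible modulo p³.
    2≤S : 2 ≤ᵥ S
    2≤S = ≤ᵥ-cancel-unit 2 p∤2 (subst (2 ≤ᵥ_) (isolate-2S S Q)
      (≤ᵥ-+ (≤ᵥ-- (≤ᵥ-weaken (s≤s (s≤s z≤n)) 3≤2S+S²-Q) (≤ᵥ-* 1≤S 1≤S)) 2≤Q))
      where
      isolate-2S : ∀ S Q → fromℕ 2 * S + S * S - Q - S * S + Q ≡ fromℕ 2 * S
      isolate-2S = solve-∀ ℚ-ring
    3≤2S-Q : 3 ≤ᵥ fromℕ 2 * S - Q
    3≤2S-Q = subst (3 ≤ᵥ_) (drop-S² S Q) (≤ᵥ-- 3≤2S+S²-Q (≤ᵥ-weaken (s≤s (s≤s (s≤s z≤n))) (≤ᵥ-* 2≤S 2≤S)))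
      where
      drop-S² : ∀ S Q → fromℕ 2 * S + S * S - Q - S * S ≡ fromℕ 2 * S - Q
      drop-S² = solve-∀ ℚ-ring

  powerSum-small : ∀ {k} → k < ℕ.pred p → 1 ≤ᵥ powerSum k p
  powerSum-small {k} k<p-1 = ≤ᵥ-cancel-unit (suc k) (p∤<p (s≤s z≤n) (subst (suc k <_) (ℕₚ.suc-pred p) (s≤s k<p-1)))
    (subst (1 ≤ᵥ_) (sym (faulhaber k p)) (≤ᵥ-∑ (suc k) _ term))
    where
    term : ∀ i → i < suc k → 1 ≤ᵥ suc k Cℚ i * B i * P ^ (suc k ∸ i)
    term i i≤k = ≤ᵥ-* (≤ᵥ-* (≤ᵥ-fromℕ (suc k C i)) (B-integral i (ℕₚ.<-≤-trans i≤k k<p-1)))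
                      (≤ᵥ-weaken (ℕₚ.m<n⇒0<n∸m i≤k) (≤ᵥ-pᵉ (suc k ∸ i)))

  powerSum-periodic : ∀ {k} → 0 < k → 1 ≤ᵥ powerSum (ℕ.pred p ℕ.+ k) p - powerSum k p
  powerSum-periodic {k} 0<k = subst (1 ≤ᵥ_) (∑-distrib-- p (λ j → fromℕ j ^ (ℕ.pred p ℕ.+ k)) (λ j → fromℕ j ^ k))
    (≤ᵥ-∑ p _ term)
    where
    instance _ = ℕ.>-nonZero 0<k
    term : ∀ j → j < p → 1 ≤ᵥ fromℕ j ^ (ℕ.pred p ℕ.+ k) - fromℕ j ^ k
    term zero    _   = subst (1 ≤ᵥ_) (sym (cong₂ _-_ (trans (^-homo-* 0ℚ (ℕ.pred p) k) (trans (cong (0ℚ ^ ℕ.pred p *_) (0ℚ^n≡0ℚ k)) (ℚₚ.*-zeroʳ (0ℚ ^ ℕ.pred p))))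
                                                   (0ℚ^n≡0ℚ k)))
                             (≤ᵥ-0ℚ 1)
    term (suc j) j<p = subst (1 ≤ᵥ_) (sym (trans (cong (_- x ^ k) (^-homo-* x (ℕ.pred p) k)) (factor (x ^ ℕ.pred p) (x ^ k))))
                             (≤ᵥ-* (fermat′ (p∤<p (s≤s z≤n) j<p)) (≤ᵥ-^ k (≤ᵥ-fromℕ (suc j))))
      where
      x = fromℕ (suc j)
      factor : ∀ a b → a * b - b ≡ (a - 1ℚ) * b
      factor = solve-∀ ℚ-ring

  factor-p : ∀ K i → i ≤ K → suc K Cℚ i * B i * P ^ (suc K ∸ i) ≡ suc K Cℚ i * (P * B i) * P ^ (K ∸ i)
  factor-p K i i≤K = trans (cong (λ e → suc K Cℚ i * B i * P ^ e) (ℕₚ.+-∸-assoc 1 i≤K)) (regroup (suc K Cℚ i) (B i) P (P ^ (K ∸ i)))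
    where
    regroup : ∀ c b P w → c * b * (P * w) ≡ c * (P * b) * w
    regroup = solve-∀ ℚ-ring

  B-integral-above : ∀ {k} → 0 < k → k < ℕ.pred p → 0 ≤ᵥ B (ℕ.pred p ℕ.+ k)
  B-integral-above {k} 0<k k<p-1 = ≤ᵥ-cancel-p (≤ᵥ-cancel-unit (suc K) p∤K+1
    (subst (1 ≤ᵥ_) (isolate (fromℕ (suc K)) (P * B K) (powerSum K p) (faulhaber-remainder K p))
      (≤ᵥ-+ (≤ᵥ-* (≤ᵥ-fromℕ (suc K)) 1≤S) (≤ᵥ-neg (≤ᵥ-∑ K _ term)))))
    where
    K = ℕ.pred p ℕ.+ k
    K<2[p-1] : K < ℕ.pred p ℕ.+ ℕ.pred p
    K<2[p-1] = ℕₚ.+-monoʳ-< (ℕ.pred p) k<p-1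
    1≤S : 1 ≤ᵥ powerSum K p
    1≤S = subst (1 ≤ᵥ_) (minus-plus (powerSum K p) (powerSum k p)) (≤ᵥ-+ (powerSum-periodic 0<k) (powerSum-small k<p-1))
      where
      minus-plus : ∀ a b → a - b + b ≡ a
      minus-plus = solve-∀ ℚ-ring
    term : ∀ i → i < K → 1 ≤ᵥ suc K Cℚ i * B i * P ^ (suc K ∸ i)
    term i i<K = subst (1 ≤ᵥ_) (sym (factor-p K i (ℕₚ.<⇒≤ i<K)))
      (≤ᵥ-* (≤ᵥ-* (≤ᵥ-fromℕ (suc K C i)) (p*B-integral i (ℕₚ.<⇒≤ (ℕₚ.<-trans i<K K<2[p-1]))))
            (≤ᵥ-weaken (ℕₚ.m<n⇒0<n∸m i<K) (≤ᵥ-pᵉ (K ∸ i))))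
    p∤K+1 : ¬ p ∣ suc K
    p∤K+1 = p∤<2p (s≤s z≤n) K+1<2p K+1≢p
      where
      q = ℕ.pred p
      K+1<2p : suc K < p ℕ.+ p
      K+1<2p = subst (λ m → suc K < m ℕ.+ m) (ℕₚ.suc-pred p)
        (s≤s (subst (suc K ≤_) (sym (ℕₚ.+-suc q q)) (s≤s (ℕₚ.+-monoʳ-≤ q (ℕₚ.<⇒≤ k<p-1)))))
      K+1≢p : suc K ≢ p
      K+1≢p K+1≡p = ℕₚ.<⇒≢ 0<k (sym (ℕₚ.+-cancelˡ-≡ q k 0 (trans (ℕₚ.suc-injective (trans K+1≡p (sym (ℕₚ.suc-pred p)))) (sym (ℕₚ.+-identityʳ q)))))
    isolate : ∀ c x s {r} → c * (x - s) ≡ - r → c * s + - r ≡ c * x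
    isolate c x s c[x-s]≡-r = trans (cong (c * s +_) (sym c[x-s]≡-r)) (cancel c x s)
      where
      cancel : ∀ c x s → c * s + c * (x - s) ≡ c * x
      cancel = solve-∀ ℚ-ring

prime[1+n+n]⇒n≢0 : ∀ {n} → Prime (suc (n ℕ.+ n)) → ℕ.NonZero n
prime[1+n+n]⇒n≢0 {zero}  prime[1] = ⊥-elim (¬prime[1] prime[1])
prime[1+n+n]⇒n≢0 {suc n} _        = _

module OddPrime {h : ℕ} (p-prime : Prime (suc (h ℕ.+ h))) where

  open import Data.Rational using (_*_)
  open Rationals
  open Sums
  open Binomials
  open Bernoulli
  open FiniteDifferences
  open PAdic p-prime

  p q : ℕ
  q = h ℕ.+ h
  p = suc q

  2≤q : 2 ≤ q
  2≤q = ℕₚ.+-mono-≤ 1≤h 1≤h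
    where 1≤h = ℕ.>-nonZero⁻¹ h {{prime[1+n+n]⇒n≢0 {h} p-prime}}

  instance
    q≢0 : ℕ.NonZero q
    q≢0 = ℕ.>-nonZero (ℕₚ.<-≤-trans (s≤s z≤n) 2≤q)

  p∤1+j : ∀ {j} → j < q → ¬ p ∣ suc j
  p∤1+j j<q = p∤<p (s≤s z≤n) (s≤s j<q)

  -- (p−1)! is the (p−1)-st finite difference of x^(p−1) at 0, and modulo p each of its p − 1 nonzero
  -- terms (−1)ᵏ C(p−1,k) k^(p−1) is 1.
  wilson-≤ᵥ : 1 ≤ᵥ fromℕ (q !) + 1ℚ
  wilson-≤ᵥ = subst (1 ≤ᵥ_) (sym q!+1≡) (≤ᵥ-+ (≤ᵥ-∑ q (λ k → v k * w k - 1ℚ) term) (≤ᵥ-multiple (∣-refl {p})))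
    where
    v w : ℕ → ℚ
    v k = (- 1ℚ) ^ suc k * q Cℚ suc k
    w k = fromℕ (suc k) ^ q
    term : ∀ k → k < q → 1 ≤ᵥ v k * w k - 1ℚ
    term k k<q = subst (1 ≤ᵥ_) (expand (v k) (w k))
      (≤ᵥ-+ (≤ᵥ-* (-1^j*[p-1]Cj≡1 k<q) (≤ᵥ-^ q (≤ᵥ-fromℕ (suc k)))) (fermat′ (p∤1+j k<q)))
      where
      expand : ∀ v w → (v - 1ℚ) * w + (w - 1ℚ) ≡ v * w - 1ℚ
      expand = solve-∀ ℚ-ring
    q!+1≡ : fromℕ (q !) + 1ℚ ≡ ∑[ k < q ] (v k * w k - 1ℚ) + P
    q!+1≡ = begin
      fromℕ (q !) + 1ℚ
        ≡⟨ cong (_+ 1ℚ) (trans (sym (ℚₚ.*-identityˡ (fromℕ (q !)))) (cong (_* fromℕ (q !)) (sym (-1^[n+n]≡1 h)))) ⟩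
      (- 1ℚ) ^ q * fromℕ (q !) + 1ℚ
        ≡⟨ cong (_+ 1ℚ) (finiteDifference-diagonal q) ⟨
      finiteDifference q q + 1ℚ
        ≡⟨ cong (_+ 1ℚ) (∑-unfoldˡ q (λ k → (- 1ℚ) ^ k * q Cℚ k * fromℕ k ^ q)) ⟩
      1ℚ * 1ℚ * 0ℚ ^ q + ∑[ k < q ] (v k * w k) + 1ℚ
        ≡⟨ cong (λ z → 1ℚ * 1ℚ * z + ∑[ k < q ] (v k * w k) + 1ℚ) (0ℚ^n≡0ℚ q) ⟩
      1ℚ * 1ℚ * 0ℚ + ∑[ k < q ] (v k * w k) + 1ℚ
        ≡⟨ cong (λ s → 1ℚ * 1ℚ * 0ℚ + s + 1ℚ) (∑-cong q (λ k _ → sym (minus-plus (v k * w k)))) ⟩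
      1ℚ * 1ℚ * 0ℚ + ∑[ k < q ] ((v k * w k - 1ℚ) + 1ℚ) + 1ℚ
        ≡⟨ cong (λ s → 1ℚ * 1ℚ * 0ℚ + s + 1ℚ) (∑-distrib-+ q (λ k → v k * w k - 1ℚ) (λ _ → 1ℚ)) ⟩
      1ℚ * 1ℚ * 0ℚ + (D + ∑[ _ < q ] 1ℚ) + 1ℚ
        ≡⟨ cong (λ s → 1ℚ * 1ℚ * 0ℚ + (D + s) + 1ℚ) (∑-const q 1ℚ) ⟩
      1ℚ * 1ℚ * 0ℚ + (D + fromℕ q * 1ℚ) + 1ℚ
        ≡⟨ regroup D (fromℕ q) ⟩
      D + (fromℕ q + 1ℚ)
        ≡⟨ cong (D +_) (fromℕ-suc q) ⟨
      D + P
        ∎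
      where
      D = ∑[ k < q ] (v k * w k - 1ℚ)
      minus-plus : ∀ x → x - 1ℚ + 1ℚ ≡ x
      minus-plus = solve-∀ ℚ-ring
      regroup : ∀ D n → 1ℚ * 1ℚ * 0ℚ + (D + n * 1ℚ) + 1ℚ ≡ D + (n + 1ℚ)
      regroup = solve-∀ ℚ-ring

  wilson : p ∣ q ! ℕ.+ 1
  wilson = subst (_∣ q ! ℕ.+ 1) (ℕₚ.*-identityʳ p) (≤ᵥ-fromℕ⇒∣ 1 (q ! ℕ.+ 1) (subst (1 ≤ᵥ_) (sym (fromℕ-homo-+ (q !) 1)) wilson-≤ᵥ))

  p∤2 : ¬ p ∣ 2
  p∤2 = p∤<p (s≤s z≤n) (s≤s 2≤q)

  δ : ℕ → ℚ
  δ j = fromℕ (suc j) ^ q - 1ℚ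

  powerSums≡deviations : fromℕ 4 * powerSum q p - powerSum (q ℕ.+ q) p - fromℕ 3 * fromℕ q ≡ fromℕ 2 * ∑ q δ - ∑[ j < q ] (δ j * δ j)
  powerSums≡deviations = begin
    fromℕ 4 * powerSum q p - powerSum (q ℕ.+ q) p - fromℕ 3 * fromℕ q
      ≡⟨ cong₂ (λ s s′ → fromℕ 4 * s - s′ - fromℕ 3 * fromℕ q) powerSum≡∑a powerSum≡∑a² ⟩
    fromℕ 4 * ∑ q a - ∑[ j < q ] (a j * a j) - fromℕ 3 * fromℕ q
      ≡⟨ cong₂ (λ s c → s - ∑[ j < q ] (a j * a j) - c) (*-distribˡ-∑ (fromℕ 4) q a) (ℚₚ.*-comm (fromℕ 3) (fromℕ q)) ⟩
    ∑[ j < q ] (fromℕ 4 * a j) - ∑[ j < q ] (a j * a j) - fromℕ q * fromℕ 3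
      ≡⟨ cong₂ (λ s c → s - c) (∑-distrib-- q (λ j → fromℕ 4 * a j) (λ j → a j * a j)) (∑-const q (fromℕ 3)) ⟨
    ∑[ j < q ] (fromℕ 4 * a j - a j * a j) - ∑[ _ < q ] fromℕ 3
      ≡⟨ ∑-distrib-- q (λ j → fromℕ 4 * a j - a j * a j) (λ _ → fromℕ 3) ⟨
    ∑[ j < q ] (fromℕ 4 * a j - a j * a j - fromℕ 3)
      ≡⟨ ∑-cong q (λ j _ → in-deviations (a j)) ⟩
    ∑[ j < q ] (fromℕ 2 * δ j - δ j * δ j)
      ≡⟨ ∑-distrib-- q (λ j → fromℕ 2 * δ j) (λ j → δ j * δ j) ⟩
    ∑[ j < q ] (fromℕ 2 * δ j) - ∑[ j < q ] (δ j * δ j)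
      ≡⟨ cong (_- ∑[ j < q ] (δ j * δ j)) (*-distribˡ-∑ (fromℕ 2) q δ) ⟨
    fromℕ 2 * ∑ q δ - ∑[ j < q ] (δ j * δ j)
      ∎
    where
    a : ℕ → ℚ
    a j = fromℕ (suc j) ^ q
    in-deviations : ∀ x → fromℕ 4 * x - x * x - fromℕ 3 ≡ fromℕ 2 * (x - 1ℚ) - (x - 1ℚ) * (x - 1ℚ)
    in-deviations = solve-∀ ℚ-ring
    0^[q+q]≡0 : 0ℚ ^ (q ℕ.+ q) ≡ 0ℚ
    0^[q+q]≡0 = trans (^-homo-* 0ℚ q q) (trans (cong (_* 0ℚ ^ q) (0ℚ^n≡0ℚ q)) (ℚₚ.*-zeroˡ (0ℚ ^ q)))
    powerSum≡∑a : powerSum q p ≡ ∑ q a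
    powerSum≡∑a = trans (∑-unfoldˡ q (λ j → fromℕ j ^ q)) (trans (cong (_+ ∑ q a) (0ℚ^n≡0ℚ q)) (ℚₚ.+-identityˡ (∑ q a)))
    powerSum≡∑a² : powerSum (q ℕ.+ q) p ≡ ∑[ j < q ] (a j * a j)
    powerSum≡∑a² = trans (∑-unfoldˡ q (λ j → fromℕ j ^ (q ℕ.+ q)))
      (trans (cong₂ _+_ 0^[q+q]≡0 (∑-cong q (λ j _ → ^-homo-* (fromℕ (suc j)) q q))) (ℚₚ.+-identityˡ _))

  powerSums-mod-p³ : 3 ≤ᵥ fromℕ (q !) + 1ℚ → 3 ≤ᵥ fromℕ 4 * powerSum q p - powerSum (q ℕ.+ q) p - fromℕ 3 * fromℕ q
  powerSums-mod-p³ 3≤q!+1 = subst (3 ≤ᵥ_) (sym powerSums≡deviations) (∏[1+t]≡1⇒2∑t≡∑t² p∤2 q δ 1≤δ 3≤∏-1)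
    where
    1≤δ : ∀ j → j < q → 1 ≤ᵥ δ j
    1≤δ j j<q = fermat′ (p∤1+j j<q)
    ∏≡q!^q : ∏[ j < q ] (1ℚ + δ j) ≡ fromℕ (q !) ^ q
    ∏≡q!^q = trans (∏-cong q (λ j _ → one-plus (fromℕ (suc j) ^ q))) (∏-powers-factorial q q)
      where
      one-plus : ∀ x → 1ℚ + (x - 1ℚ) ≡ x
      one-plus = solve-∀ ℚ-ring
    3≤∏-1 : 3 ≤ᵥ ∏[ j < q ] (1ℚ + δ j) - 1ℚ
    3≤∏-1 = subst (3 ≤ᵥ_) (cong₂ _-_ (sym ∏≡q!^q) (-1^[n+n]≡1 h)) (≤ᵥ-^-≡-1 (≤ᵥ-fromℕ (q !)) 3≤q!+1 q)

-- p = 2h + 1 with h = g + 2: then p ≥ 5, and p ∸ 1 = h + h holds by computation.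
module AtLeastFive (g : ℕ) (p-prime : Prime (suc (suc (suc g) ℕ.+ suc (suc g)))) where
  open import Data.Rational using (_*_)
  open Rationals
  open Sums
  open Binomials
  open Bernoulli
  open PAdic p-prime
  open OddPrime {suc (suc g)} p-prime

  vanishing-term : ∀ K {i} → B i ≡ 0ℚ → ∀ e → e ≤ᵥ suc K Cℚ i * B i * P ^ (suc K ∸ i)
  vanishing-term K {i} Bᵢ≡0 e = subst (e ≤ᵥ_) (sym (trans (cong (λ b → suc K Cℚ i * b * P ^ (suc K ∸ i)) Bᵢ≡0)
    (trans (cong (_* P ^ (suc K ∸ i)) (ℚₚ.*-zeroʳ (suc K Cℚ i))) (ℚₚ.*-zeroˡ (P ^ (suc K ∸ i)))))) (≤ᵥ-0ℚ e)

  pB-S[p-1] : 3 ≤ᵥ P * B q - powerSum q p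
  pB-S[p-1] = ≤ᵥ-cancel-p (subst (4 ≤ᵥ_) (sym (faulhaber-remainder q p)) (≤ᵥ-neg (≤ᵥ-∑ q _ term)))
    where
    term : ∀ i → i < q → 4 ≤ᵥ p Cℚ i * B i * P ^ (p ∸ i)
    term zero    _   = ≤ᵥ-* (≤ᵥ-fromℕ 1) (≤ᵥ-weaken (s≤s (s≤s (s≤s (ℕₚ.≤-trans (s≤s z≤n) (ℕₚ.m≤n+m (suc (suc g)) g))))) (≤ᵥ-pᵉ p))
    term (suc i) i<q with ℕₚ.m≤n⇒m<n∨m≡n i<q
    ... | inj₂ 2+i≡q = vanishing-term q {suc i} (trans (cong B 1+i≡3+2g) (B-odd g)) 4
      where
      1+i≡3+2g : suc i ≡ suc (suc (suc (g ℕ.+ g)))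
      1+i≡3+2g = cong suc (trans (ℕₚ.suc-injective (ℕₚ.suc-injective 2+i≡q)) (trans (ℕₚ.+-suc g (suc g)) (cong suc (ℕₚ.+-suc g g))))
    ... | inj₁ 2+i<q = ≤ᵥ-* (≤ᵥ-* (≤ᵥ-multiple (p∣pCj (s≤s z≤n) (s≤s (ℕₚ.<⇒≤ i<q)))) (B-integral (suc i) i<q))
                            (≤ᵥ-weaken (ℕₚ.m+n≤o⇒m≤o∸n 3 2+i<q) (≤ᵥ-pᵉ (p ∸ suc i)))

  pB-S[2p-2] : 3 ≤ᵥ P * B (q ℕ.+ q) - powerSum (q ℕ.+ q) p
  pB-S[2p-2] = ≤ᵥ-cancel-unit (suc K) p∤K+1 (subst (3 ≤ᵥ_) (sym (faulhaber-remainder K p)) (≤ᵥ-neg (≤ᵥ-∑ K _ term)))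
    where
    K = q ℕ.+ q
    p∤K+1 : ¬ p ∣ suc K
    p∤K+1 = p∤<2p (s≤s z≤n) (s≤s (ℕₚ.≤-reflexive (sym (ℕₚ.+-suc q q))))
      (λ K+1≡p → ℕ.≢-nonZero⁻¹ q (ℕₚ.+-cancelˡ-≡ q q 0 (trans (ℕₚ.suc-injective K+1≡p) (sym (ℕₚ.+-identityʳ q)))))
    k : ℕ
    k = suc (suc (g ℕ.+ g))
    k<q : k < q
    k<q = s≤s (s≤s (ℕₚ.+-monoʳ-< g (ℕₚ.<-trans (ℕₚ.n<1+n g) (ℕₚ.n<1+n (suc g)))))
    K≡4+2k : K ≡ suc (suc (suc (suc (k ℕ.+ k))))
    K≡4+2k = arithmetic g
      where
      arithmetic : ∀ g → (suc (suc g) ℕ.+ suc (suc g)) ℕ.+ (suc (suc g) ℕ.+ suc (suc g))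
                       ≡ 4 ℕ.+ (suc (suc (g ℕ.+ g)) ℕ.+ suc (suc (g ℕ.+ g)))
      arithmetic = ℕ-Solver.solve-∀
    K≡2+q+k : K ≡ suc (suc (q ℕ.+ k))
    K≡2+q+k = arithmetic g
      where
      arithmetic : ∀ g → (suc (suc g) ℕ.+ suc (suc g)) ℕ.+ (suc (suc g) ℕ.+ suc (suc g))
                       ≡ 2 ℕ.+ ((suc (suc g) ℕ.+ suc (suc g)) ℕ.+ suc (suc (g ℕ.+ g)))
      arithmetic = ℕ-Solver.solve-∀
    term : ∀ i → i < K → 3 ≤ᵥ suc K Cℚ i * B i * P ^ (suc K ∸ i)
    term i i<K with ℕₚ.m≤n⇒m<n∨m≡n i<K
    ... | inj₂ 1+i≡K = vanishing-term K {i} (trans (cong B (ℕₚ.suc-injective (trans 1+i≡K K≡4+2k))) (B-odd k)) 3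
    ... | inj₁ 1+i<K with ℕₚ.m≤n⇒m<n∨m≡n 1+i<K
    ...   | inj₂ 2+i≡K = subst (3 ≤ᵥ_) (cong (λ e → suc K Cℚ i * B i * P ^ e) exponent)
      (≤ᵥ-* (≤ᵥ-* (≤ᵥ-fromℕ (suc K C i)) (subst (λ j → 0 ≤ᵥ B j) q+k≡i (B-integral-above (s≤s z≤n) k<q))) (≤ᵥ-pᵉ 3))
      where
      q+k≡i : q ℕ.+ k ≡ i
      q+k≡i = ℕₚ.suc-injective (ℕₚ.suc-injective (trans (sym K≡2+q+k) (sym 2+i≡K)))
      exponent : 3 ≡ suc K ∸ i
      exponent = trans (sym (ℕₚ.m+n∸n≡m 3 i)) (cong (λ m → suc m ∸ i) 2+i≡K)
    ...   | inj₁ 2+i<K = subst (3 ≤ᵥ_) (sym (factor-p K i (ℕₚ.<⇒≤ i<K)))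
      (≤ᵥ-* (≤ᵥ-* (≤ᵥ-fromℕ (suc K C i)) (p*B-integral i (ℕₚ.<⇒≤ i<K))) (≤ᵥ-weaken (ℕₚ.m+n≤o⇒m≤o∸n 3 2+i<K) (≤ᵥ-pᵉ (K ∸ i))))

  superWilson⇒p³∣[p-1]!+1 : p ℕ.* p ∣ W p → 3 ≤ᵥ fromℕ (q !) + 1ℚ
  superWilson⇒p³∣[p-1]!+1 (divides w W≡w*p*p) = subst (3 ≤ᵥ_) (sym cast) (≤ᵥ-fromℤ*pᵉ (ℤ.+ w) 3)
    where
    q!+1≡w*p³ : q ! ℕ.+ 1 ≡ w ℕ.* p ℕ.^ 3
    q!+1≡w*p³ = begin
      q ! ℕ.+ 1                   ≡⟨ m*[n/m]≡n wilson ⟨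
      p ℕ.* W p                   ≡⟨ cong (p ℕ.*_) W≡w*p*p ⟩
      p ℕ.* (w ℕ.* (p ℕ.* p))     ≡⟨ regroup p w ⟩
      w ℕ.* p ℕ.^ 3               ∎
      where
      regroup : ∀ p w → p ℕ.* (w ℕ.* (p ℕ.* p)) ≡ w ℕ.* (p ℕ.* (p ℕ.* (p ℕ.* 1)))
      regroup = ℕ-Solver.solve-∀
    cast : fromℕ (q !) + 1ℚ ≡ fromℤ (ℤ.+ w) * P ^ 3
    cast = begin
      fromℕ (q !) + 1ℚ            ≡⟨ fromℕ-homo-+ (q !) 1 ⟨
      fromℕ (q ! ℕ.+ 1)           ≡⟨ cong fromℕ q!+1≡w*p³ ⟩
      fromℕ (w ℕ.* p ℕ.^ 3)       ≡⟨ fromℕ-homo-* w (p ℕ.^ 3) ⟩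
      fromℕ w * fromℕ (p ℕ.^ 3)   ≡⟨ cong (fromℕ w *_) (fromℕ-homo-^ p 3) ⟩
      fromℕ w * P ^ 3             ∎

  p*difference : P * (fromℕ 4 * (B q - R p) - (B (2 ℕ.* q) - R p))
               ≡ fromℕ 4 * (P * B q - powerSum q p) - (P * B (q ℕ.+ q) - powerSum (q ℕ.+ q) p)
                 + (fromℕ 4 * powerSum q p - powerSum (q ℕ.+ q) p - fromℕ 3 * fromℕ q)
  p*difference = begin
    P * (fromℕ 4 * (B q - (1ℚ - u)) - (B (2 ℕ.* q) - (1ℚ - u)))
      ≡⟨ cong (λ k → P * (fromℕ 4 * (B q - (1ℚ - u)) - (B (q ℕ.+ k) - (1ℚ - u)))) (ℕₚ.+-identityʳ q) ⟩
    P * (fromℕ 4 * (B q - (1ℚ - u)) - (B (q ℕ.+ q) - (1ℚ - u)))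
      ≡⟨ expand P u (B q) (B (q ℕ.+ q)) ⟩
    fromℕ 4 * (P * B q) - P * B (q ℕ.+ q) - fromℕ 3 * P + fromℕ 3 * (P * u)
      ≡⟨ cong₂ (λ x y → fromℕ 4 * (P * B q) - P * B (q ℕ.+ q) - fromℕ 3 * x + fromℕ 3 * y) (fromℕ-suc q) (fromℕ-suc*1/suc q) ⟩
    fromℕ 4 * (P * B q) - P * B (q ℕ.+ q) - fromℕ 3 * (fromℕ q + 1ℚ) + fromℕ 3 * 1ℚ
      ≡⟨ regroup (P * B q) (P * B (q ℕ.+ q)) (powerSum q p) (powerSum (q ℕ.+ q) p) (fromℕ q) ⟩
    fromℕ 4 * (P * B q - powerSum q p) - (P * B (q ℕ.+ q) - powerSum (q ℕ.+ q) p)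
      + (fromℕ 4 * powerSum q p - powerSum (q ℕ.+ q) p - fromℕ 3 * fromℕ q)
      ∎
    where
    u = ℤ.+ 1 / p
    expand : ∀ P u b₁ b₂ → P * (fromℕ 4 * (b₁ - (1ℚ - u)) - (b₂ - (1ℚ - u)))
                          ≡ fromℕ 4 * (P * b₁) - P * b₂ - fromℕ 3 * P + fromℕ 3 * (P * u)
    expand = solve-∀ ℚ-ring
    regroup : ∀ x₁ x₂ s₁ s₂ n → fromℕ 4 * x₁ - x₂ - fromℕ 3 * (n + 1ℚ) + fromℕ 3 * 1ℚ
                              ≡ fromℕ 4 * (x₁ - s₁) - (x₂ - s₂) + (fromℕ 4 * s₁ - s₂ - fromℕ 3 * n)
    regroup = solve-∀ ℚ-ring

  superWilson⇒congruence : p ℕ.* p ∣ W p → (fromℕ 4 * (B (p ∸ 1) - R p)) ≡ (B (2 ℕ.* (p ∸ 1)) - R p) [modp² p ]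
  superWilson⇒congruence superWilson =
    2≤ᵥ⇒≡[modp²] (fromℕ 4 * (B q - R p)) (B (2 ℕ.* q) - R p) (≤ᵥ-cancel-p (subst (3 ≤ᵥ_) (sym p*difference) 3≤p*difference))
    where
    3≤p*difference : 3 ≤ᵥ fromℕ 4 * (P * B q - powerSum q p) - (P * B (q ℕ.+ q) - powerSum (q ℕ.+ q) p)
                          + (fromℕ 4 * powerSum q p - powerSum (q ℕ.+ q) p - fromℕ 3 * fromℕ q)
    3≤p*difference = ≤ᵥ-+ (≤ᵥ-- (≤ᵥ-* (≤ᵥ-fromℕ 4) pB-S[p-1]) pB-S[2p-2])
                          (powerSums-mod-p³ (superWilson⇒p³∣[p-1]!+1 superWilson))

even⊎odd : ∀ n → (∃[ k ] n ≡ k ℕ.+ k) ⊎ (∃[ k ] n ≡ suc (k ℕ.+ k))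
even⊎odd zero    = inj₁ (0 , refl)
even⊎odd (suc n) with even⊎odd n
... | inj₁ (k , n≡2k)   = inj₂ (k , cong suc n≡2k)
... | inj₂ (k , n≡2k+1) = inj₁ (suc k , cong suc (trans n≡2k+1 (sym (ℕₚ.+-suc k k))))

prime>3⇒≡5+2g : ∀ {p} → Prime p → 3 < p → ∃[ g ] p ≡ suc (suc (suc g) ℕ.+ suc (suc g))
prime>3⇒≡5+2g {p} p-prime 3<p with even⊎odd p
... | inj₁ (k , p≡2k) = ⊥-elim (prime⇒¬composite p-prime (composite-≢ 2 {{_}} {{prime⇒nonZero p-prime}} 2≢p 2∣p))
  where
  2≢p : 2 ≢ p
  2≢p 2≡p = ℕₚ.<-asym 3<p (subst (_< 3) 2≡p (s≤s (s≤s (s≤s z≤n))))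
  2∣p : 2 ∣ p
  2∣p = divides k (trans p≡2k (trans (cong (k ℕ.+_) (sym (ℕₚ.+-identityʳ k))) (ℕₚ.*-comm 2 k)))
... | inj₂ (0 , refl)           = ⊥-elim (ℕₚ.<⇒≱ 3<p (s≤s z≤n))
... | inj₂ (1 , refl)           = ⊥-elim (ℕₚ.<-irrefl refl 3<p)
... | inj₂ (suc (suc g) , p≡5+2g) = g , p≡5+2g

open import Data.Nat using (ℕ; _>_; _*_; _∸_; NonZero)
open import Data.Nat.Divisibility using (_∣_)
open import Data.Nat.Primality using (Prime)
open import Data.Integer using (+_)
open import Data.Rational using (_-_; _/_) renaming (_*_ to _*ℚ_)

corollary2p7 : (p : ℕ) → .{{_ : NonZero p}} → Prime p → p > 3 →
    (p * p) ∣ W p →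
    ((+ 4 / 1) *ℚ (B (p ∸ 1) - R p)) ≡ (B (2 * (p ∸ 1)) - R p) [modp² p ]
corollary2p7 p p-prime p>3 superWilson with prime>3⇒≡5+2g p-prime p>3
... | g , refl = AtLeastFive.superWilson⇒congruence g p-prime superWilson
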